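{- If $k\ge1$ is an integer, then $\gamma_{\rm SMB}'(S(2k,2k,2k))=\lceil\log_2(4k+1)\rceil+1$.
   Context: $S(n_1,\dots,n_\ell)$ is the subdivided star obtained from paths $P_{n_1},\dots,P_{n_\ell}$ and a new central vertex $x$ by making $x$ adjacent to one end of each path. The Maker-Breaker domination game on a finite simple graph $G$: Dominator and Staller alternately claim previously unclaimed vertices. Staller wins if she claims all vertices of the closed neighborhood $N_G[v]$ of some vertex $v$; otherwise Dominator wins. In the S-game Staller moves first. $\gamma_{\rm SMB}'(G)$ is the minimum number of moves Staller needs to win the S-game under optimal play (Staller minimizing, Dominator preventing or delaying), $\infty$ if she cannot win. -}

module Defs where

open import Data.Nat using (ℕ; zero; suc; _<_)
open import Data.Fin using (Fin; toℕ) renaming (_≟_ to _≟ᶠ_)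
open import Data.List using (List; length; lookup)
open import Data.Maybe using (Maybe; just; nothing)
open import Data.Product using (Σ; _×_; _,_)
open import Data.Sum using (_⊎_)
open import Data.Empty using (⊥)
open import Relation.Nullary using (¬_; yes; no)
open import Relation.Binary.Definitions using (DecidableEquality)
open import Relation.Binary.PropositionalEquality using (_≡_)
import Data.Maybe.Properties as MP
import Data.Product.Properties as PP

record Graph : Set₁ where
  field
    V    : Set
    _≟_  : DecidableEquality V
    Adj  : V → V → Set

module _ (G : Graph) where
  open Graph G

  _∈N[_] : V → V → Set
  u ∈N[ v ] = (u ≡ v) ⊎ Adj v u

  data Owner : Set where
    free dom sta : Owner

  Board : Set
  Board = V → Owner

  emptyBoard : Board
  emptyBoard _ = free

  claim : Board → V → Owner → Board
  claim b u o w with w ≟ u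
  ... | yes _ = o
  ... | no  _ = b w

  StallerClaimedNbhd : Board → Set
  StallerClaimedNbhd b = Σ V λ v → ∀ u → u ∈N[ v ] → b u ≡ sta

  -- Players alternate and must claim an unclaimed vertex;
  -- the game ends (with Dominator winning) when no vertex is unclaimed.
  StallerWinsWithin : ℕ → Board → Set
  StallerWinsWithin zero    b = ⊥
  StallerWinsWithin (suc m) b =
    Σ V λ u → b u ≡ free ×
      ( StallerClaimedNbhd (claim b u sta)
      ⊎ ( (Σ V λ w → claim b u sta w ≡ free)
        × (∀ w → claim b u sta w ≡ free →
             StallerWinsWithin m (claim (claim b u sta) w dom))))

  γ'SMB≡ : ℕ → Set
  γ'SMB≡ L = StallerWinsWithin L emptyBoard
           × (∀ m → m < L → ¬ StallerWinsWithin m emptyBoard)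

-- Subdivided star S(n₁,…,n_ℓ): central vertex x (= nothing) and, for each
-- path index i, vertices (i , j) with j < nᵢ; (i , 0) is adjacent to x and
-- (i , j) is adjacent to (i , j+1).

StarV : List ℕ → Set
StarV ns = Maybe (Σ (Fin (length ns)) λ i → Fin (lookup ns i))

data StarAdj (ns : List ℕ) : StarV ns → StarV ns → Set where
  centre-leg : ∀ i j → toℕ j ≡ 0 → StarAdj ns nothing (just (i , j))
  leg-centre : ∀ i j → toℕ j ≡ 0 → StarAdj ns (just (i , j)) nothing
  leg-next   : ∀ i j j' → toℕ j' ≡ suc (toℕ j) → StarAdj ns (just (i , j)) (just (i , j'))
  leg-prev   : ∀ i j j' → toℕ j ≡ suc (toℕ j') → StarAdj ns (just (i , j)) (just (i , j'))

SubdividedStar : List ℕ → Graph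
SubdividedStar ns = record
  { V   = StarV ns
  ; _≟_ = MP.≡-dec (PP.≡-dec _≟ᶠ_ _≟ᶠ_)
  ; Adj = StarAdj ns
  }

-- Upper bound: if the 2h+1 vertices of a free path have no neighbours outside the path except Staller's
-- vertices, Staller wins within ⌈log₂ (h+1)⌉ + 1 moves, by claiming an odd-indexed vertex in the middle and
-- continuing on whichever of the two remaining odd halves Dominator did not touch.  In S(2k,2k,2k) she claims
-- the vertices of legs 0 and 1 next to the centre; Dominator must answer inside the rest of that leg each time,
-- else those 2k-1 vertices form such a path, and then the centre with leg 2 forms one of 2k+1 vertices.
--
-- Lower bound: Dominator keeps a pairing such that every closed neighbourhood contains one of his vertices or a
-- whole pair, except the neighbourhoods of the vertices of a free unpaired path ("zone") of odd length n, and
-- answers a move on a paired vertex by claiming its partner.  A move on the zone, or on an unpaired vertex, is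
-- answered so that the zone vanishes or shrinks to at least half its length, so Staller needs more than log₂ n
-- moves.  Staller's first move in S(2k,2k,2k) leaves no zone (at the centre) or one of length 4k+1.

module Submission where

open import Data.Bool using (Bool; true; if_then_else_)
open import Data.Empty using (⊥; ⊥-elim)
open import Data.Fin using (Fin; toℕ; fromℕ<) renaming (zero to fzero; suc to fsuc)
open import Data.Fin.Properties using (toℕ-fromℕ<; fromℕ<-toℕ; toℕ<n) renaming (_≟_ to _≟ᶠ_)
open import Data.List using (List; _∷_; []; lookup)
open import Data.Maybe using (Maybe; just; nothing)
import Data.Maybe as Maybe
open import Data.Maybe.Properties using (just-injective)
open import Data.Nat
open import Data.Nat.Induction using (<-wellFounded)
open import Data.Nat.Logarithm using (⌈log₂_⌉)
open import Data.Nat.Logarithm.Core using (⌈log2⌉; ⌈log2⌉-cong-irr)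
open import Data.Nat.Properties
open import Data.Nat.Tactic.RingSolver using (solve-∀)
open import Data.Product using (Σ-syntax; _×_; _,_; proj₁; proj₂; swap)
open import Data.Sum using (_⊎_; inj₁; inj₂; map₁)
open import Function using (_∘_)
open import Induction.WellFounded using (Acc; acc)
open import Relation.Nullary using (¬_; Dec; yes; no; contradiction)
open import Relation.Nullary.Decidable using (_⊎-dec_; does; dec-true; dec-false)
open import Relation.Binary.Definitions using (tri<; tri≈; tri>)
open import Relation.Binary.PropositionalEquality

open import Defs

2*⌈n/2⌉≤1+n : ∀ n → 2 * ⌈ n /2⌉ ≤ suc n
2*⌈n/2⌉≤1+n zero = z≤n
2*⌈n/2⌉≤1+n (suc zero) = ≤-refl
2*⌈n/2⌉≤1+n (suc (suc n)) = begin
  2 * suc ⌈ n /2⌉         ≡⟨ *-suc 2 ⌈ n /2⌉ ⟩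
  2 + 2 * ⌈ n /2⌉         ≤⟨ +-monoʳ-≤ 2 (2*⌈n/2⌉≤1+n n) ⟩
  suc (suc (suc n))       ∎
  where open ≤-Reasoning

n≤2*⌈n/2⌉ : ∀ n → n ≤ 2 * ⌈ n /2⌉
n≤2*⌈n/2⌉ zero = z≤n
n≤2*⌈n/2⌉ (suc zero) = s≤s z≤n
n≤2*⌈n/2⌉ (suc (suc n)) = begin
  suc (suc n)             ≤⟨ +-monoʳ-≤ 2 (n≤2*⌈n/2⌉ n) ⟩
  2 + 2 * ⌈ n /2⌉         ≡⟨ *-suc 2 ⌈ n /2⌉ ⟨
  2 * suc ⌈ n /2⌉         ∎
  where open ≤-Reasoning

n≤2^⌈log2⌉n : ∀ n (acc : Acc _<_ n) → n ≤ 2 ^ ⌈log2⌉ n acc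
n≤2^⌈log2⌉n zero _ = z≤n
n≤2^⌈log2⌉n (suc zero) _ = s≤s z≤n
n≤2^⌈log2⌉n (suc (suc n)) (acc rs) =
  ≤-trans (n≤2*⌈n/2⌉ (suc (suc n))) (*-monoʳ-≤ 2 (n≤2^⌈log2⌉n (suc ⌈ n /2⌉) _))

2^⌈log2⌉[1+n]≤2n : ∀ n (acc : Acc _<_ (suc n)) → n ≡ 0 ⊎ 2 ^ ⌈log2⌉ (suc n) acc ≤ 2 * n
2^⌈log2⌉[1+n]≤2n zero _ = inj₁ refl
2^⌈log2⌉[1+n]≤2n (suc n) (acc rs) with 2^⌈log2⌉[1+n]≤2n ⌈ n /2⌉ (rs _)
... | inj₁ ⌈n/2⌉≡0 = inj₂ (*-monoʳ-≤ 2 (≤-trans (≤-reflexive (cong (2 ^_) log≡0)) (s≤s z≤n)))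
  where
  log≡0 : ⌈log2⌉ (suc ⌈ n /2⌉) _ ≡ 0
  log≡0 = ⌈log2⌉-cong-irr {acc' = <-wellFounded 1} (cong suc ⌈n/2⌉≡0)
... | inj₂ le = inj₂ (*-monoʳ-≤ 2 (≤-trans le (2*⌈n/2⌉≤1+n n)))

n≤2^⌈log₂n⌉ : ∀ n → n ≤ 2 ^ ⌈log₂ n ⌉
n≤2^⌈log₂n⌉ n = n≤2^⌈log2⌉n n (<-wellFounded n)

2^⌈log₂[1+n]⌉≤2n : ∀ n → 1 ≤ n → 2 ^ ⌈log₂ (suc n) ⌉ ≤ 2 * n
2^⌈log₂[1+n]⌉≤2n n 1≤n with 2^⌈log2⌉[1+n]≤2n n (<-wellFounded (suc n))
... | inj₁ refl = contradiction 1≤n λ ()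
... | inj₂ le = le

Near : ℕ → ℕ → Set
Near i s = s ≡ i ⊎ suc s ≡ i ⊎ s ≡ suc i

Near⇒bounds : ∀ {i s} → Near i s → i ≤ suc s × s ≤ suc i
Near⇒bounds (inj₁ refl) = n≤1+n _ , n≤1+n _
Near⇒bounds (inj₂ (inj₁ refl)) = ≤-refl , ≤-trans (n≤1+n _) (n≤1+n _)
Near⇒bounds (inj₂ (inj₂ refl)) = ≤-trans (n≤1+n _) (n≤1+n _) , ≤-refl

bounds⇒Near : ∀ {i s} → i ≤ suc s → s ≤ suc i → Near i s
bounds⇒Near {i} {s} i≤ s≤ with <-cmp s i
... | tri≈ _ s≡i _ = inj₁ s≡i
... | tri< s<i _ _ = inj₂ (inj₁ (≤-antisym s<i i≤))
... | tri> _ _ i<s = inj₂ (inj₂ (≤-antisym s≤ i<s))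

Near⇒≤ : ∀ {i s m} → Near i s → i < m → s ≤ m
Near⇒≤ near i<m = ≤-trans (proj₂ (Near⇒bounds near)) i<m

Near⇒≥ : ∀ {i s m} → Near i s → m < i → m ≤ s
Near⇒≥ near m<i = ≤-pred (<-≤-trans m<i (proj₁ (Near⇒bounds near)))

far⇒¬Near : ∀ {i s} → suc (suc i) ≤ s → ¬ Near i s
far⇒¬Near far near = <⇒≱ far (proj₂ (Near⇒bounds near))

¬Near⇒far : ∀ {i s} → i ≤ s → ¬ Near i s → suc (suc i) ≤ s
¬Near⇒far {i} {s} i≤s ¬near with suc i <? s
... | yes far = far
... | no s≮ = contradiction (bounds⇒Near (≤-trans i≤s (n≤1+n s)) (≮⇒≥ s≮)) ¬near

Near-cancelˡ : ∀ a {j s} → Near (a + j) (a + s) → Near j s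
Near-cancelˡ a (inj₁ e) = inj₁ (+-cancelˡ-≡ a _ _ e)
Near-cancelˡ a {s = s} (inj₂ (inj₁ e)) = inj₂ (inj₁ (+-cancelˡ-≡ a _ _ (trans (+-suc a s) e)))
Near-cancelˡ a {j} (inj₂ (inj₂ e)) = inj₂ (inj₂ (+-cancelˡ-≡ a _ _ (trans e (sym (+-suc a j)))))

Near-+ˡ : ∀ a {j s} → Near j s → Near (a + j) (a + s)
Near-+ˡ a (inj₁ e) = inj₁ (cong (a +_) e)
Near-+ˡ a {s = s} (inj₂ (inj₁ e)) = inj₂ (inj₁ (trans (sym (+-suc a s)) (cong (a +_) e)))
Near-+ˡ a {j} (inj₂ (inj₂ e)) = inj₂ (inj₂ (trans (cong (a +_) e) (+-suc a j)))

Near-sym : ∀ {i s} → Near i s → Near s i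
Near-sym (inj₁ e) = inj₁ (sym e)
Near-sym (inj₂ (inj₁ e)) = inj₂ (inj₂ (sym e))
Near-sym (inj₂ (inj₂ e)) = inj₂ (inj₁ (sym e))

near? : ∀ i s → Dec (Near i s)
near? i s = (s ≟ i) ⊎-dec (suc s ≟ i) ⊎-dec (s ≟ suc i)

2*m≤1+2*n⇒m≤n : ∀ {m n} → 2 * m ≤ suc (2 * n) → m ≤ n
2*m≤1+2*n⇒m≤n {m} {n} le with m ≤? n
... | yes m≤n = m≤n
... | no m≰n = ⊥-elim (1+n≰n (subst (_≤ suc (2 * n)) (*-suc 2 n)
                                    (≤-trans (*-monoʳ-≤ 2 (≰⇒> m≰n)) le)))

m+m≤1+n⇒m≤n : ∀ {m n} → m + m ≤ suc n → m ≤ n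
m+m≤1+n⇒m≤n {zero} _ = z≤n
m+m≤1+n⇒m≤n {suc m} (s≤s le) = ≤-trans (m≤n+m (suc m) m) le

neighbour : ∀ {n j} → 1 < n → j < n → Σ[ j' ∈ ℕ ] j' < n × j' ≢ j × Near j j'
neighbour {n} {j} 1<n j<n with suc j <? n
... | yes sj<n = suc j , sj<n , 1+n≢n , inj₂ (inj₂ refl)
neighbour {j = zero} 1<n _ | no 1≮n = contradiction 1<n 1≮n
neighbour {j = suc j} _ j<n | no _ = j , <-trans (n<1+n j) j<n , 1+n≢n ∘ sym , inj₂ (inj₁ refl)

mate : ℕ → ℕ
mate zero = 1
mate (suc zero) = 0
mate (suc (suc n)) = suc (suc (mate n))

mate-involutive : ∀ n → mate (mate n) ≡ n
mate-involutive zero = refl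
mate-involutive (suc zero) = refl
mate-involutive (suc (suc n)) = cong (suc ∘ suc) (mate-involutive n)

mate-near : ∀ n → Near n (mate n)
mate-near zero = inj₂ (inj₂ refl)
mate-near (suc zero) = inj₂ (inj₁ refl)
mate-near (suc (suc n)) = Near-+ˡ 2 (mate-near n)

mate-irrefl : ∀ n → mate n ≢ n
mate-irrefl zero ()
mate-irrefl (suc zero) ()
mate-irrefl (suc (suc n)) e = mate-irrefl n (suc-injective (suc-injective e))

mate-< : ∀ c {n} → n < c + c → mate n < c + c
mate-< zero ()
mate-< (suc c) {zero} _ = s≤s (subst (1 ≤_) (sym (+-suc c c)) (s≤s z≤n))
mate-< (suc c) {suc zero} _ = s≤s z≤n
mate-< (suc c) {suc (suc n)} (s≤s n<) =
  s≤s (subst (suc (suc (mate n)) ≤_) (sym (+-suc c c))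
             (s≤s (mate-< c (≤-pred (subst (suc (suc n) ≤_) (+-suc c c) n<)))))

even-or-odd : ∀ i → Σ[ e ∈ ℕ ] (i ≡ e + e ⊎ i ≡ suc (e + e))
even-or-odd zero = 0 , inj₁ refl
even-or-odd (suc i) with even-or-odd i
... | e , inj₁ refl = e , inj₂ refl
... | e , inj₂ refl = suc e , inj₁ (cong suc (sym (+-suc e e)))

module Blocks (a B c : ℕ) where

  blockMate : ℕ → Maybe ℕ
  blockMate j with j <? a + a
  ... | yes _ = just (mate j)
  ... | no _ with B ≤? j
  ...   | no _ = nothing
  ...   | yes _ with j ∸ B <? c + c
  ...     | yes _ = just (B + mate (j ∸ B))
  ...     | no _ = nothing

  InBlocks : ℕ → Set
  InBlocks j = j < a + a ⊎ (B ≤ j × j < B + (c + c))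

  data BlockMates : ℕ → ℕ → Set where
    low  : ∀ {j} → j < a + a → BlockMates j (mate j)
    high : ∀ {t} → t < c + c → BlockMates (B + t) (B + mate t)

  blockMate-low : ∀ {j} → j < a + a → blockMate j ≡ just (mate j)
  blockMate-low {j} j< with j <? a + a
  ... | yes _ = refl
  ... | no j≮ = contradiction j< j≮

  blockMate-high : a + a ≤ B → ∀ {t} → t < c + c → blockMate (B + t) ≡ just (B + mate t)
  blockMate-high 2a≤B {t} t< with B + t <? a + a
  ... | yes B+t< = contradiction (≤-trans 2a≤B (m≤m+n B t)) (<⇒≱ B+t<)
  ... | no _ with B ≤? B + t
  ...   | no B≰ = contradiction (m≤m+n B t) B≰
  ...   | yes _ with B + t ∸ B <? c + c
  ...     | yes _ = cong (λ x → just (B + mate x)) (m+n∸m≡n B t)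
  ...     | no t≮ = contradiction (subst (_< c + c) (sym (m+n∸m≡n B t)) t<) t≮

  blockMate-gap : ∀ {j} → a + a ≤ j → j < B → blockMate j ≡ nothing
  blockMate-gap {j} 2a≤j j<B with j <? a + a
  ... | yes j< = contradiction 2a≤j (<⇒≱ j<)
  ... | no _ with B ≤? j
  ...   | no _ = refl
  ...   | yes B≤j = contradiction B≤j (<⇒≱ j<B)

  blockMate-view : ∀ {j j'} → blockMate j ≡ just j' → BlockMates j j'
  blockMate-view {j} e with j <? a + a
  ... | yes j< rewrite just-injective (sym e) = low j<
  ... | no _ with B ≤? j
  ...   | no _ = contradiction e λ ()
  ...   | yes B≤j with j ∸ B <? c + c
  ...     | no _ = contradiction e λ ()
  ...     | yes t< rewrite just-injective (sym e) =
            subst (λ x → BlockMates x (B + mate (j ∸ B))) (m+[n∸m]≡n B≤j) (high t<)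

  blockMates-sym : a + a ≤ B → ∀ {j j'} → BlockMates j j' → blockMate j' ≡ just j
  blockMates-sym _ (low {j} j<) = trans (blockMate-low (mate-< a j<)) (cong just (mate-involutive j))
  blockMates-sym 2a≤B (high {t} t<) =
    trans (blockMate-high 2a≤B (mate-< c t<)) (cong (λ x → just (B + x)) (mate-involutive t))

  blockMates-irrefl : ∀ {j j'} → BlockMates j j' → j ≢ j'
  blockMates-irrefl (low {j} _) e = mate-irrefl j (sym e)
  blockMates-irrefl (high {t} _) e = mate-irrefl t (sym (+-cancelˡ-≡ B _ _ e))

  blockMates-near : ∀ {j j'} → BlockMates j j' → Near j j'
  blockMates-near (low {j} _) = mate-near j
  blockMates-near (high {t} _) = Near-+ˡ B (mate-near t)

  blockMates-inBlocks : ∀ {j j'} → BlockMates j j' → InBlocks j × InBlocks j'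
  blockMates-inBlocks (low {j} j<) = inj₁ j< , inj₁ (mate-< a j<)
  blockMates-inBlocks (high {t} t<) =
    inj₂ (m≤m+n B t , +-monoʳ-< B t<) , inj₂ (m≤m+n B (mate t) , +-monoʳ-< B (mate-< c t<))

  inBlocks-mate : ∀ {j} → a + a ≤ B → InBlocks j → Σ[ j' ∈ ℕ ] blockMate j ≡ just j'
  inBlocks-mate _ (inj₁ j<) = mate _ , blockMate-low j<
  inBlocks-mate 2a≤B (inj₂ (B≤j , j<)) with m≤n⇒∃[o]m+o≡n B≤j
  ... | t , refl = B + mate t , blockMate-high 2a≤B (+-cancelˡ-< B t (c + c) j<)

module Moves (G : Graph) where
  open Graph G renaming (_≟_ to _≟ᵥ_)

  _∈N_ : V → V → Set
  u ∈N v = _∈N[_] G u v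

  free≢sta : free {G} ≢ sta
  free≢sta ()

  free≢dom : free {G} ≢ dom
  free≢dom ()

  sta≢dom : sta {G} ≢ dom
  sta≢dom ()

  claim-updates : ∀ b u (o : Owner G) → claim G b u o u ≡ o
  claim-updates b u o with u ≟ᵥ u
  ... | yes _ = refl
  ... | no u≢u = contradiction refl u≢u

  claim-minimal : ∀ b u (o : Owner G) {w} → w ≢ u → claim G b u o w ≡ b w
  claim-minimal b u o {w} w≢u with w ≟ᵥ u
  ... | yes w≡u = contradiction w≡u w≢u
  ... | no _ = refl

  claim-keeps-free : ∀ b u (o : Owner G) {w} → w ≢ u → b w ≡ free → claim G b u o w ≡ free
  claim-keeps-free b u o w≢u bw = trans (claim-minimal b u o w≢u) bw

  claim-keeps-claimed : ∀ b u (o : Owner G) {w o'} → b u ≡ free → b w ≡ o' → o' ≢ free →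
                        claim G b u o w ≡ o'
  claim-keeps-claimed b u o {w} bu bw o'≢free with w ≟ᵥ u
  ... | yes refl = contradiction (trans (sym bw) bu) o'≢free
  ... | no _ = bw

  claim-sta : ∀ b u {w} → w ≡ u ⊎ b w ≡ sta → claim G b u sta w ≡ sta
  claim-sta b u {w} w≡u⊎sta with w ≟ᵥ u | w≡u⊎sta
  ... | yes _ | _ = refl
  ... | no w≢u | inj₁ w≡u = contradiction w≡u w≢u
  ... | no _ | inj₂ bw = bw

  round : Board G → V → V → Board G
  round b u w = claim G (claim G b u sta) w dom

  module Round {b u w} (uf : b u ≡ free) (wf : claim G b u sta w ≡ free) where

    round-dom : round b u w w ≡ dom
    round-dom = claim-updates _ w dom

    round-sta : round b u w u ≡ sta
    round-sta = claim-keeps-claimed _ w dom wf (claim-updates b u sta) λ ()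

    round-keeps-claimed : ∀ {y o} → b y ≡ o → o ≢ free → round b u w y ≡ o
    round-keeps-claimed by o≢free =
      claim-keeps-claimed _ w dom wf (claim-keeps-claimed b u sta uf by o≢free) o≢free

    round-keeps-free : ∀ {y} → y ≢ u → y ≢ w → b y ≡ free → round b u w y ≡ free
    round-keeps-free y≢u y≢w by = claim-keeps-free _ w dom y≢w (claim-keeps-free b u sta y≢u by)

  module StallerClaims {b u v} (owns : ∀ y → y ∈N v → claim G b u sta y ≡ sta) where

    free-is-u : ∀ {y} → y ∈N v → b y ≡ free → y ≡ u
    free-is-u {y} y∈N by with y ≟ᵥ u
    ... | yes y≡u = y≡u
    ... | no y≢u =
          ⊥-elim (free≢sta (trans (sym by) (trans (sym (claim-minimal b u sta y≢u)) (owns y y∈N))))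

    two-free : ∀ {y z} → y ∈N v → z ∈N v → b y ≡ free → b z ≡ free → y ≡ z
    two-free y∈N z∈N by bz = trans (free-is-u y∈N by) (sym (free-is-u z∈N bz))

    not-dom : b u ≡ free → ∀ {y} → y ∈N v → b y ≢ dom
    not-dom uf {y} y∈N by with y ≟ᵥ u
    ... | yes refl = free≢dom (trans (sym uf) by)
    ... | no y≢u = sta≢dom (trans (sym (owns y y∈N)) (trans (claim-minimal b u sta y≢u) by))

  StallerWinsAfter : ℕ → Board G → V → Set
  StallerWinsAfter r b u = ∀ w → claim G b u sta w ≡ free → StallerWinsWithin G r (round b u w)

module PathStrategy (G : Graph) where
  open Graph G renaming (_≟_ to _≟ᵥ_)
  open Moves G

  record StallerPath (b : Board G) (v : ℕ → V) (n : ℕ) : Set where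
    field
      path-free : ∀ i → i < n → b (v i) ≡ free
      path-injective : ∀ i j → i < n → j < n → v i ≡ v j → i ≡ j
      path-closed : ∀ i → i < n → ∀ u → u ∈N v i →
                    (Σ[ s ∈ ℕ ] s < n × Near i s × u ≡ v s) ⊎ b u ≡ sta

  module Halves {b : Board G} {v : ℕ → V} {N : ℕ} (path : StallerPath b v N)
                {m : ℕ} (m<N : m < N) {w : V} (wf : claim G b (v m) sta w ≡ free) where
    open StallerPath path

    round-owns : ∀ {u} → u ≡ v m ⊎ b u ≡ sta → round b (v m) w u ≡ sta
    round-owns u≡vm⊎sta = claim-keeps-claimed _ w dom wf (claim-sta b (v m) u≡vm⊎sta) (λ ())

    round-free : ∀ i → i < N → i ≢ m → w ≢ v i → round b (v m) w (v i) ≡ free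
    round-free i i<N i≢m w≢vi =
      claim-keeps-free _ w dom (w≢vi ∘ sym)
        (claim-keeps-free b (v m) sta (i≢m ∘ path-injective i m i<N m<N) (path-free i i<N))

    left-half : (∀ i → i < m → w ≢ v i) → StallerPath (round b (v m) w) v m
    left-half w∉left = record
      { path-free = λ i i<m → round-free i (<-trans i<m m<N) (<⇒≢ i<m) (w∉left i i<m)
      ; path-injective = λ i j i<m j<m → path-injective i j (<-trans i<m m<N) (<-trans j<m m<N)
      ; path-closed = closed }
      where
      closed : ∀ i → i < m → ∀ u → u ∈N v i →
               (Σ[ s ∈ ℕ ] s < m × Near i s × u ≡ v s) ⊎ round b (v m) w u ≡ sta
      closed i i<m u u∈N with path-closed i (<-trans i<m m<N) u u∈N
      ... | inj₂ bu = inj₂ (round-owns (inj₂ bu))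
      ... | inj₁ (s , _ , near , u≡vs) with m≤n⇒m<n∨m≡n (Near⇒≤ near i<m)
      ...   | inj₁ s<m = inj₁ (s , s<m , near , u≡vs)
      ...   | inj₂ refl = inj₂ (round-owns (inj₁ u≡vs))

    right-half : ∀ n → N ≡ suc m + n → (∀ j → j < n → w ≢ v (suc m + j)) →
                 StallerPath (round b (v m) w) (λ j → v (suc m + j)) n
    right-half n N≡ w∉right = record
      { path-free = λ j j<n → round-free _ (inN j<n) (m≢ j ∘ sym) (w∉right j j<n)
      ; path-injective = λ j j' j<n j'<n → +-cancelˡ-≡ (suc m) _ _ ∘ path-injective _ _ (inN j<n) (inN j'<n)
      ; path-closed = closed }
      where
      inN : ∀ {j} → j < n → suc m + j < N
      inN j<n = subst (_ <_) (sym N≡) (+-monoʳ-< (suc m) j<n)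
      m<right : ∀ j → m < suc m + j
      m<right j = s≤s (m≤m+n m j)
      m≢ : ∀ j → m ≢ suc m + j
      m≢ j = <⇒≢ (m<right j)
      closed : ∀ j → j < n → ∀ u → u ∈N v (suc m + j) →
               (Σ[ s ∈ ℕ ] s < n × Near j s × u ≡ v (suc m + s)) ⊎ round b (v m) w u ≡ sta
      closed j j<n u u∈N with path-closed _ (inN j<n) u u∈N
      ... | inj₂ bu = inj₂ (round-owns (inj₂ bu))
      ... | inj₁ (s , s<N , near , u≡vs) with m≤n⇒m<n∨m≡n (Near⇒≥ near (m<right j))
      ...   | inj₂ refl = inj₂ (round-owns (inj₁ u≡vs))
      ...   | inj₁ m<s with m≤n⇒∃[o]m+o≡n m<s
      ...     | d , refl = inj₁ (d , +-cancelˡ-< (suc m) d n (subst (_ <_) N≡ s<N) ,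
                                 Near-cancelˡ (suc m) near , u≡vs)

  path-length : ∀ a c → suc (2 * suc (a + c)) ≡ suc (suc (2 * a)) + suc (2 * c)
  path-length = solve-∀

  -- Claiming v (2⌊h/2⌋+1) splits the path into odd paths of 2⌊h/2⌋+1 and 2⌈h/2⌉+1 vertices.
  path-wins : ∀ r h {b v} → h < 2 ^ r → StallerPath b v (suc (2 * h)) → StallerWinsWithin G (suc r) b
  path-wins r zero {b} {v} _ path = v 0 , path-free 0 z<s , inj₁ (v 0 , owns)
    where
    open StallerPath path
    owns : ∀ u → u ∈N v 0 → claim G b (v 0) sta u ≡ sta
    owns u u∈N with path-closed 0 z<s u u∈N
    ... | inj₁ (zero , _ , _ , u≡v0) = claim-sta b (v 0) (inj₁ u≡v0)
    ... | inj₁ (suc _ , s≤s () , _)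
    ... | inj₂ bu = claim-sta b (v 0) (inj₂ bu)
  path-wins zero (suc h) (s≤s ())
  path-wins (suc r) (suc h) {b} {v} 1+h<2^1+r path =
    v m , path-free m m<N , inj₂ ((v 0 , v0-free) , respond)
    where
    open StallerPath path
    h₁ h₂ m : ℕ
    h₁ = ⌊ h /2⌋
    h₂ = ⌈ h /2⌉
    m = suc (2 * h₁)
    N≡ : suc (2 * suc h) ≡ suc m + suc (2 * h₂)
    N≡ = trans (cong (λ x → suc (2 * suc x)) (sym (⌊n/2⌋+⌈n/2⌉≡n h))) (path-length h₁ h₂)
    m<N : m < suc (2 * suc h)
    m<N = subst (m <_) (sym N≡) (m≤m+n (suc m) _)
    v0-free : claim G b (v m) sta (v 0) ≡ free
    v0-free = claim-keeps-free b (v m) sta (λ e → 0≢1+n (path-injective 0 m z<s m<N e)) (path-free 0 z<s)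
    h₂<2^r : h₂ < 2 ^ r
    h₂<2^r = *-cancelˡ-< 2 h₂ (2 ^ r) (≤-<-trans (2*⌈n/2⌉≤1+n h) 1+h<2^1+r)
    h₁<2^r : h₁ < 2 ^ r
    h₁<2^r = ≤-<-trans (⌊n/2⌋≤⌈n/2⌉ h) h₂<2^r
    open Halves path m<N
    respond : ∀ w → claim G b (v m) sta w ≡ free → StallerWinsWithin G (suc r) (round b (v m) w)
    respond w wf with anyUpTo? (λ i → w ≟ᵥ v i) m
    ... | no w∉left = path-wins r h₁ h₁<2^r (left-half wf (λ i i<m w≡vi → w∉left (i , i<m , w≡vi)))
    ... | yes (i , i<m , w≡vi) = path-wins r h₂ h₂<2^r (right-half wf _ N≡ w∉right)
      where
      w∉right : ∀ j → j < suc (2 * h₂) → w ≢ v (suc m + j)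
      w∉right j j<n w≡vj = <⇒≢ (<-≤-trans i<m (≤-trans (n≤1+n m) (m≤m+n (suc m) j)))
        (path-injective i (suc m + j) (<-trans i<m m<N)
                        (subst (suc m + j <_) (sym N≡) (+-monoʳ-< (suc m) j<n)) (trans (sym w≡vi) w≡vj))

module Pairings (G : Graph) where
  open Graph G renaming (_≟_ to _≟ᵥ_)
  open Moves G

  Intact : Board G → V → V → Set
  Intact b y z = (b y ≡ free × b z ≡ free) ⊎ b y ≡ dom ⊎ b z ≡ dom

  intact-free-or-dom : ∀ b {y z} → b y ≡ free ⊎ b y ≡ dom → b z ≡ free ⊎ b z ≡ dom →
                       Intact b y z
  intact-free-or-dom _ (inj₁ by) (inj₁ bz) = inj₁ (by , bz)
  intact-free-or-dom _ (inj₂ by) _ = inj₂ (inj₁ by)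
  intact-free-or-dom _ (inj₁ _) (inj₂ bz) = inj₂ (inj₂ bz)

  record Pairing (b : Board G) (partner : V → Maybe V) : Set where
    field
      partner-sym : ∀ y z → partner y ≡ just z → partner z ≡ just y
      partner-irrefl : ∀ y z → partner y ≡ just z → y ≢ z
      partner-intact : ∀ y z → partner y ≡ just z → Intact b y z

  Guarded : Board G → (V → Maybe V) → V → Set
  Guarded b partner v = (Σ[ y ∈ V ] y ∈N v × b y ≡ dom)
                      ⊎ (Σ[ y ∈ V ] Σ[ z ∈ V ] y ∈N v × z ∈N v × partner y ≡ just z)

  record Blocked (b : Board G) : Set where
    field
      partner : V → Maybe V
      pairing : Pairing b partner
      guarded : ∀ v → Guarded b partner v

  module _ {b u w} (uf : b u ≡ free) (wf : claim G b u sta w ≡ free) where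
    open Round uf wf

    Guarded-round : ∀ {partner v} → Guarded b partner v → Guarded (round b u w) partner v
    Guarded-round (inj₁ (y , y∈N , by)) = inj₁ (y , y∈N , round-keeps-claimed by (λ ()))
    Guarded-round (inj₂ pair) = inj₂ pair

    Pairing-round : ∀ {partner} → Pairing b partner →
                    (∀ z → partner u ≡ just z → round b u w z ≡ dom) → Pairing (round b u w) partner
    Pairing-round {partner} pairing partner-taken = record
      { partner-sym = partner-sym ; partner-irrefl = partner-irrefl ; partner-intact = intact }
      where
      open Pairing pairing
      intact-round : ∀ {y z} → y ≢ u → z ≢ u → Intact b y z → Intact (round b u w) y z
      intact-round _ _ (inj₂ (inj₁ by)) = inj₂ (inj₁ (round-keeps-claimed by (λ ())))
      intact-round _ _ (inj₂ (inj₂ bz)) = inj₂ (inj₂ (round-keeps-claimed bz (λ ())))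
      intact-round {y} {z} y≢u z≢u (inj₁ (by , bz)) = by-cases (y ≟ᵥ w) (z ≟ᵥ w)
        where
        by-cases : Dec (y ≡ w) → Dec (z ≡ w) → Intact (round b u w) y z
        by-cases (yes refl) _ = inj₂ (inj₁ round-dom)
        by-cases (no _) (yes refl) = inj₂ (inj₂ round-dom)
        by-cases (no y≢w) (no z≢w) = inj₁ (round-keeps-free y≢u y≢w by , round-keeps-free z≢u z≢w bz)
      intact : ∀ y z → partner y ≡ just z → Intact (round b u w) y z
      intact y z yz with y ≟ᵥ u | z ≟ᵥ u
      ... | yes refl | _ = inj₂ (inj₂ (partner-taken z yz))
      ... | no _ | yes refl = inj₂ (inj₁ (partner-taken y (partner-sym y u yz)))
      ... | no y≢u | no z≢u = intact-round y≢u z≢u (partner-intact y z yz)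

    Blocked-round : (blocked : Blocked b) → Pairing (round b u w) (Blocked.partner blocked) →
                    Blocked (round b u w)
    Blocked-round blocked pairing' =
      record { partner = _ ; pairing = pairing' ; guarded = Guarded-round ∘ Blocked.guarded blocked }

  Pairing-round-unpaired : ∀ {b partner u} → Pairing b partner → b u ≡ free → partner u ≡ nothing →
                           ∀ w (wf : claim G b u sta w ≡ free) → Pairing (round b u w) partner
  Pairing-round-unpaired pairing uf pu w wf =
    Pairing-round uf wf pairing (λ z e → contradiction (trans (sym pu) e) λ ())

  Pairing-round-paired : ∀ {b partner u u' w} → Pairing b partner → b u ≡ free → (wf : claim G b u sta w ≡ free) →
                         partner u ≡ just u' → round b u w u' ≡ dom → Pairing (round b u w) partner
  Pairing-round-paired {b} {u = u} {w = w} pairing uf wf pu taken = Pairing-round uf wf pairing λ z e →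
    subst (λ x → round b u w x ≡ dom) (just-injective (trans (sym pu) e)) taken

  pairing-answer : ∀ {b partner u} → Pairing b partner → b u ≡ free →
    (Σ[ u' ∈ V ] partner u ≡ just u' × Σ[ wf ∈ claim G b u sta u' ≡ free ]
       Pairing (round b u u') partner)
    ⊎ (∀ w (wf : claim G b u sta w ≡ free) → Pairing (round b u w) partner)
  pairing-answer {b} {partner} {u} pairing uf with partner u in eq
  ... | nothing = inj₂ (Pairing-round-unpaired pairing uf eq)
  ... | just u' with Pairing.partner-intact pairing u u' eq
  ...   | inj₂ (inj₁ bu) = contradiction (trans (sym uf) bu) free≢dom
  ...   | inj₂ (inj₂ bu') =
          inj₂ λ w wf → Pairing-round-paired pairing uf wf eq (Round.round-keeps-claimed uf wf bu' λ ())
  ...   | inj₁ (_ , bu') = inj₁ (u' , refl , u'f , Pairing-round-paired pairing uf u'f eq (Round.round-dom uf u'f))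
    where
    u'f : claim G b u sta u' ≡ free
    u'f = claim-keeps-free b u sta (λ u'≡u → Pairing.partner-irrefl pairing u u' eq (sym u'≡u)) bu'

  guarded-no-win : ∀ {b partner u v} → b u ≡ free → Pairing b partner → Guarded b partner v →
                   ¬ (∀ y → y ∈N v → claim G b u sta y ≡ sta)
  guarded-no-win uf _ (inj₁ (y , y∈N , by)) owns = StallerClaims.not-dom owns uf y∈N by
  guarded-no-win uf pairing (inj₂ (y , z , y∈N , z∈N , yz)) owns with Pairing.partner-intact pairing y z yz
  ... | inj₁ (by , bz) = Pairing.partner-irrefl pairing y z yz (two-free y∈N z∈N by bz)
    where open StallerClaims owns
  ... | inj₂ (inj₁ by) = StallerClaims.not-dom owns uf y∈N by
  ... | inj₂ (inj₂ bz) = StallerClaims.not-dom owns uf z∈N bz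

  blocked-safe : ∀ r {b} → Blocked b → ¬ StallerWinsWithin G r b
  blocked-safe zero _ ()
  blocked-safe (suc r) blocked (u , uf , inj₁ (v , owns)) =
    guarded-no-win uf (Blocked.pairing blocked) (Blocked.guarded blocked v) owns
  blocked-safe (suc r) blocked (u , uf , inj₂ ((w₀ , w₀f) , next))
    with pairing-answer (Blocked.pairing blocked) uf
  ... | inj₁ (u' , _ , u'f , pairing') = blocked-safe r (Blocked-round uf u'f blocked pairing') (next u' u'f)
  ... | inj₂ pairing' = blocked-safe r (Blocked-round uf w₀f blocked (pairing' w₀ w₀f)) (next w₀ w₀f)

module Zones (G : Graph) where
  open Graph G renaming (_≟_ to _≟ᵥ_)
  open Moves G
  open Pairings G

  record Zone (b : Board G) (n : ℕ) : Set where
    field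
      partner : V → Maybe V
      pairing : Pairing b partner
      path : ℕ → V
      path-free : ∀ j → j < n → b (path j) ≡ free
      path-unpaired : ∀ j → j < n → partner (path j) ≡ nothing
      path-injective : ∀ i j → i < n → j < n → path i ≡ path j → i ≡ j
      path-adjacent : ∀ j → suc j < n → path (suc j) ∈N path j × path j ∈N path (suc j)
      guarded : ∀ v → Guarded b partner v ⊎ (Σ[ j ∈ ℕ ] j < n × v ≡ path j)

    path-near : ∀ {i j} → i < n → j < n → Near i j → path j ∈N path i
    path-near _ _ (inj₁ refl) = inj₁ refl
    path-near i<n _ (inj₂ (inj₁ refl)) = proj₂ (path-adjacent _ i<n)
    path-near _ j<n (inj₂ (inj₂ refl)) = proj₁ (path-adjacent _ j<n)

    onPath? : ∀ y → Dec (Σ[ j ∈ ℕ ] j < n × y ≡ path j)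
    onPath? y = anyUpTo? (λ j → y ≟ᵥ path j) n

    paired-off-path : ∀ {y z} → partner y ≡ just z → ∀ j → j < n → y ≢ path j
    paired-off-path yz j j<n refl = contradiction (trans (sym yz) (path-unpaired j j<n)) λ ()

  Zone-reverse : ∀ {b m} → Zone b (suc m) → Zone b (suc m)
  Zone-reverse {b} {m} Z = record
    { partner = partner
    ; pairing = pairing
    ; path = path ∘ (m ∸_)
    ; path-free = λ j _ → path-free (m ∸ j) (s≤s (m∸n≤m m j))
    ; path-unpaired = λ j _ → path-unpaired (m ∸ j) (s≤s (m∸n≤m m j))
    ; path-injective = λ i j i<n j<n e →
        ∸-cancelˡ-≡ (≤-pred i<n) (≤-pred j<n)
          (path-injective _ _ (s≤s (m∸n≤m m i)) (s≤s (m∸n≤m m j)) e)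
    ; path-adjacent = adjacent
    ; guarded = reflect ∘ guarded }
    where
    open Zone Z
    adjacent : ∀ j → suc j < suc m →
               path (m ∸ suc j) ∈N path (m ∸ j) × path (m ∸ j) ∈N path (m ∸ suc j)
    adjacent j (s≤s j<m) rewrite +-∸-assoc 1 j<m =
      swap (path-adjacent (m ∸ suc j) (s≤s (subst (_≤ m) (+-∸-assoc 1 j<m) (m∸n≤m m j))))
    reflect : ∀ {v} → Guarded b partner v ⊎ (Σ[ j ∈ ℕ ] j < suc m × v ≡ path j) →
              Guarded b partner v ⊎ (Σ[ j ∈ ℕ ] j < suc m × v ≡ path (m ∸ j))
    reflect (inj₁ guard) = inj₁ guard
    reflect (inj₂ (j , j<n , refl)) =
      inj₂ (m ∸ j , s≤s (m∸n≤m m j) , cong path (sym (m∸[m∸n]≡n (≤-pred j<n))))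

  -- Dominator answers by claiming path d and pairs the path blockwise; the gap indices near d are guarded by
  -- path d, the others are left over.
  module Answer {b n} (Z : Zone b n) {u} (uf : b u ≡ free) {d} (d<n : d < n)
                (wf : claim G b u sta (Zone.path Z d) ≡ free)
                (pairing-round : Pairing (round b u (Zone.path Z d)) (Zone.partner Z))
                {a B c} (2a≤B : a + a ≤ B) (B+2c≡n : B + (c + c) ≡ n)
                (blocks-avoid : ∀ j → Blocks.InBlocks a B c j → j ≢ d × Zone.path Z j ≢ u) where
    open Zone Z
    open Round uf wf
    open Blocks a B c

    B≤n : B ≤ n
    B≤n = subst (B ≤_) B+2c≡n (m≤m+n B (c + c))

    inBlocks⇒<n : ∀ {j} → InBlocks j → j < n
    inBlocks⇒<n (inj₁ j<) = <-≤-trans j< (≤-trans 2a≤B B≤n)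
    inBlocks⇒<n {j} (inj₂ (_ , j<)) = subst (j <_) B+2c≡n j<

    free-after : ∀ {j} → j < n → j ≢ d → path j ≢ u → round b u (path d) (path j) ≡ free
    free-after j<n j≢d pj≢u = round-keeps-free pj≢u (j≢d ∘ path-injective _ _ j<n d<n) (path-free _ j<n)

    partner' : V → Maybe V
    partner' y with onPath? y
    ... | yes (j , _ , _) = Maybe.map path (blockMate j)
    ... | no _ = partner y

    partner'-path : ∀ j → j < n → partner' (path j) ≡ Maybe.map path (blockMate j)
    partner'-path j j<n with onPath? (path j)
    ... | yes (i , i<n , e) = cong (Maybe.map path ∘ blockMate) (path-injective i j i<n j<n (sym e))
    ... | no off = contradiction (j , j<n , refl) off

    partner'-off : ∀ {y} → ¬ (Σ[ j ∈ ℕ ] j < n × y ≡ path j) → partner' y ≡ partner y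
    partner'-off {y} off with onPath? y
    ... | yes on = contradiction on off
    ... | no _ = refl

    partner'-paired : ∀ {y z} → partner y ≡ just z → partner' y ≡ just z
    partner'-paired yz = trans (partner'-off λ (j , j<n , e) → paired-off-path yz j j<n e) yz

    data Partners' (y z : V) : Set where
      zone-pair : ∀ {j j'} → BlockMates j j' → y ≡ path j → z ≡ path j' → Partners' y z
      old-pair : ¬ (Σ[ j ∈ ℕ ] j < n × y ≡ path j) → partner y ≡ just z → Partners' y z

    partner'-view : ∀ {y z} → partner' y ≡ just z → Partners' y z
    partner'-view {y} e with onPath? y
    ... | no off = old-pair off e
    ... | yes (j , _ , refl) with blockMate j in mj
    ...   | just j' = zone-pair (blockMate-view mj) refl (just-injective (sym e))
    ...   | nothing = contradiction e λ ()

    Leftover : ℕ → Set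
    Leftover j = a + a ≤ j × j < B × ¬ Near d j

    pairing' : Pairing (round b u (path d)) partner'
    pairing' = record { partner-sym = sym' ; partner-irrefl = irrefl' ; partner-intact = intact' }
      where
      mates<n : ∀ {j j'} → BlockMates j j' → j < n × j' < n
      mates<n m = inBlocks⇒<n (proj₁ (blockMates-inBlocks m)) , inBlocks⇒<n (proj₂ (blockMates-inBlocks m))
      sym' : ∀ y z → partner' y ≡ just z → partner' z ≡ just y
      sym' y z e with partner'-view e
      ... | zone-pair m refl refl =
            trans (partner'-path _ (proj₂ (mates<n m))) (cong (Maybe.map path) (blockMates-sym 2a≤B m))
      ... | old-pair _ yz = partner'-paired (Pairing.partner-sym pairing y z yz)
      irrefl' : ∀ y z → partner' y ≡ just z → y ≢ z
      irrefl' y z e with partner'-view e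
      ... | zone-pair m refl refl =
            blockMates-irrefl m ∘ path-injective _ _ (proj₁ (mates<n m)) (proj₂ (mates<n m))
      ... | old-pair _ yz = Pairing.partner-irrefl pairing y z yz
      intact' : ∀ y z → partner' y ≡ just z → Intact (round b u (path d)) y z
      intact' y z e with partner'-view e
      ... | zone-pair m refl refl = inj₁ (free-in-blocks (proj₁ (blockMates-inBlocks m)) ,
                                          free-in-blocks (proj₂ (blockMates-inBlocks m)))
        where
        free-in-blocks : ∀ {j} → InBlocks j → round b u (path d) (path j) ≡ free
        free-in-blocks ib =
          free-after (inBlocks⇒<n ib) (proj₁ (blocks-avoid _ ib)) (proj₂ (blocks-avoid _ ib))
      ... | old-pair _ yz = Pairing.partner-intact pairing-round y z yz

    blocks-guarded : ∀ {j} → InBlocks j → Guarded (round b u (path d)) partner' (path j)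
    blocks-guarded {j} ib with inBlocks-mate 2a≤B ib
    ... | j' , mj = inj₂ (path j , path j' , inj₁ refl ,
                          path-near (inBlocks⇒<n ib) (inBlocks⇒<n (proj₂ (blockMates-inBlocks mates)))
                                    (blockMates-near mates) ,
                          trans (partner'-path j (inBlocks⇒<n ib)) (cong (Maybe.map path) mj))
      where
      mates : BlockMates j j'
      mates = blockMate-view mj

    path-guarded : ∀ j → j < n → Guarded (round b u (path d)) partner' (path j) ⊎ Leftover j
    path-guarded j j<n with j <? a + a | B ≤? j
    ... | yes j< | _ = inj₁ (blocks-guarded (inj₁ j<))
    ... | no _ | yes B≤j = inj₁ (blocks-guarded (inj₂ (B≤j , subst (j <_) (sym B+2c≡n) j<n)))
    ... | no j≮ | no B≰j with near? d j
    ...   | yes near = inj₁ (inj₁ (path d , path-near j<n d<n (Near-sym near) , round-dom))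
    ...   | no far = inj₂ (≮⇒≥ j≮ , ≰⇒> B≰j , far)

    guarded' : ∀ v → Guarded (round b u (path d)) partner' v ⊎ (Σ[ j ∈ ℕ ] Leftover j × v ≡ path j)
    guarded' v with guarded v
    ... | inj₁ (inj₁ (y , y∈N , by)) = inj₁ (inj₁ (y , y∈N , round-keeps-claimed by λ ()))
    ... | inj₁ (inj₂ (y , z , y∈N , z∈N , yz)) =
          inj₁ (inj₂ (y , z , y∈N , z∈N , partner'-paired yz))
    ... | inj₂ (j , j<n , refl) with path-guarded j j<n
    ...   | inj₁ guard = inj₁ guard
    ...   | inj₂ left = inj₂ (j , left , refl)

    answer-blocked : (∀ j → a + a ≤ j → j < B → Near d j) → Blocked (round b u (path d))
    answer-blocked all-near = record { partner = partner' ; pairing = pairing' ; guarded = guard }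
      where
      guard : ∀ v → Guarded (round b u (path d)) partner' v
      guard v with guarded' v
      ... | inj₁ g = g
      ... | inj₂ (j , (2a≤j , j<B , far) , _) = contradiction (all-near j 2a≤j j<B) far

    answer-zone : ∀ off n' → (∀ t → t < n' → Leftover (off + t) × path (off + t) ≢ u) →
                  (∀ j → Leftover j → Σ[ t ∈ ℕ ] t < n' × j ≡ off + t) →
                  Zone (round b u (path d)) n'
    answer-zone off n' window covers = record
      { partner = partner'
      ; pairing = pairing'
      ; path = path ∘ (off +_)
      ; path-free = λ t t<n' → free-after (in-zone t<n') (far⇒≢ t<n') (proj₂ (window t t<n'))
      ; path-unpaired = λ t t<n' → let (2a≤ , <B , _) = proj₁ (window t t<n') in
          trans (partner'-path _ (in-zone t<n')) (cong (Maybe.map path) (blockMate-gap 2a≤ <B))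
      ; path-injective = λ t t' t< t'< → +-cancelˡ-≡ off _ _ ∘ path-injective _ _ (in-zone t<) (in-zone t'<)
      ; path-adjacent = adjacent
      ; guarded = guard }
      where
      in-zone : ∀ {t} → t < n' → off + t < n
      in-zone t<n' = <-≤-trans (proj₁ (proj₂ (proj₁ (window _ t<n')))) B≤n
      far⇒≢ : ∀ {t} → t < n' → off + t ≢ d
      far⇒≢ t<n' e = proj₂ (proj₂ (proj₁ (window _ t<n'))) (inj₁ e)
      adjacent : ∀ t → suc t < n' →
                 path (off + suc t) ∈N path (off + t) × path (off + t) ∈N path (off + suc t)
      adjacent t st<n' rewrite +-suc off t =
        path-adjacent (off + t) (subst (_< n) (+-suc off t) (in-zone st<n'))
      guard : ∀ v → Guarded (round b u (path d)) partner' v ⊎ (Σ[ t ∈ ℕ ] t < n' × v ≡ path (off + t))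
      guard v with guarded' v
      ... | inj₁ g = inj₁ g
      ... | inj₂ (j , left , refl) with covers j left
      ...   | t , t<n' , refl = inj₂ (t , t<n' , refl)

  zone-no-win : ∀ {b n u v} → Zone b n → 1 < n → b u ≡ free →
                ¬ (∀ y → y ∈N v → claim G b u sta y ≡ sta)
  zone-no-win {v = v} Z 1<n uf owns with Zone.guarded Z v
  ... | inj₁ guard = guarded-no-win uf (Zone.pairing Z) guard owns
  ... | inj₂ (j , j<n , refl) with neighbour 1<n j<n
  ...   | j' , j'<n , j'≢j , near =
    j'≢j (path-injective _ _ j'<n j<n
      (two-free (path-near j<n j'<n near) (inj₁ refl) (path-free j' j'<n) (path-free j j<n)))
    where
    open Zone Z
    open StallerClaims owns

  Zone-round : ∀ {b n u u'} (Z : Zone b n) (uf : b u ≡ free) (u'f : claim G b u sta u' ≡ free) →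
               ¬ (Σ[ j ∈ ℕ ] j < n × u ≡ Zone.path Z j) → Zone.partner Z u ≡ just u' →
               Pairing (round b u u') (Zone.partner Z) → Zone (round b u u') n
  Zone-round {u = u} {u'} Z uf u'f off pu pairing' = record
    { partner = partner
    ; pairing = pairing'
    ; path = path
    ; path-free = λ j j<n → round-keeps-free (λ e → off (j , j<n , sym e))
                             (paired-off-path (Pairing.partner-sym pairing u u' pu) j j<n ∘ sym)
                             (path-free j j<n)
    ; path-unpaired = path-unpaired
    ; path-injective = path-injective
    ; path-adjacent = path-adjacent
    ; guarded = map₁ (Guarded-round uf u'f) ∘ guarded }
    where
    open Zone Z
    open Round uf u'f

  ZoneSafe : ℕ → Set
  ZoneSafe r = ∀ {b} h → Zone b (suc (2 * h)) → 2 ^ r ≤ suc (2 * h) → ¬ StallerWinsWithin G r b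

  odd-answer-length : ∀ e f → suc (suc (suc (e + e))) + (f + f) ≡ suc (2 * suc (e + f))
  odd-answer-length = solve-∀

  -- Dominator's answer path (2e+1) guards path 2e, 2e+1 and 2e+2; the rest of the path gets paired.
  odd-answer-safe : ∀ r {b} e f (Z : Zone b (suc (2 * suc (e + f)))) {u} → b u ≡ free →
                    (∀ j → j < suc (2 * suc (e + f)) → Zone.path Z j ≡ u → j ≡ e + e) →
                    (∀ w → claim G b u sta w ≡ free → Pairing (round b u w) (Zone.partner Z)) →
                    ¬ StallerWinsAfter r b u
  odd-answer-safe r {b} e f Z {u} uf only-at pairing-after next =
    blocked-safe r (answer-blocked all-near) (next (path d) wf)
    where
    open Zone Z
    d B : ℕ
    d = suc (e + e)
    B = suc (suc d)
    B≤n : B ≤ suc (2 * suc (e + f))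
    B≤n = subst (B ≤_) (odd-answer-length e f) (m≤m+n B (f + f))
    d<B : d < B
    d<B = <-trans (n<1+n d) (n<1+n (suc d))
    d<n : d < suc (2 * suc (e + f))
    d<n = <-≤-trans d<B B≤n
    wf : claim G b u sta (path d) ≡ free
    wf = claim-keeps-free b u sta (1+n≢n ∘ only-at d d<n) (path-free d d<n)
    avoid : ∀ j → Blocks.InBlocks e B f j → j ≢ d × path j ≢ u
    avoid j (inj₁ j<2e) = <⇒≢ (<-trans j<2e (n<1+n _)) ,
                          λ pj≡u → <⇒≢ j<2e (only-at j (<-trans j<2e (<-trans (n<1+n _) d<n)) pj≡u)
    avoid j (inj₂ (B≤j , j<)) = (λ j≡d → <⇒≱ d<B (subst (B ≤_) j≡d B≤j)) ,
                                λ pj≡u → <⇒≱ (<-trans (n<1+n _) d<B)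
                                  (subst (B ≤_) (only-at j (subst (j <_) (odd-answer-length e f) j<) pj≡u)
                                         B≤j)
    open Answer Z uf d<n wf (pairing-after (path d) wf)
                {a = e} {B} {f} (≤-trans (n≤1+n _) (<⇒≤ d<B)) (odd-answer-length e f) avoid
    all-near : ∀ j → e + e ≤ j → j < B → Near d j
    all-near j 2e≤j j<B = bounds⇒Near (s≤s 2e≤j) (≤-pred j<B)

  odd-move-length : ∀ e x → suc (suc (e + e)) + suc (2 * (e + x)) ≡ suc (2 * (suc (e + e) + x))
  odd-move-length = solve-∀

  odd-move-halves : ∀ e x → suc (2 * (e + x)) ≡ (suc (e + e) + x) + x
  odd-move-halves = solve-∀

  -- Dominator's answer path 2e leaves path 2e+2, …, n-1 as the new zone, which is at least half as long.
  odd-move-safe : ∀ r {b} e x (Z : Zone b (suc (2 * (suc (e + e) + x)))) → ZoneSafe r →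
                  2 ^ suc r ≤ suc (2 * (suc (e + e) + x)) → b (Zone.path Z (suc (e + e))) ≡ free →
                  ¬ StallerWinsAfter r b (Zone.path Z (suc (e + e)))
  odd-move-safe r {b} e x Z safe big uf next =
    safe (e + x) (answer-zone off n' window covers) small (next (path d) wf)
    where
    open Zone Z
    i d off n n' : ℕ
    i = suc (e + e)
    d = e + e
    off = suc (suc (e + e))
    n = suc (2 * (suc (e + e) + x))
    n' = suc (2 * (e + x))
    i<n : i < n
    i<n = <-≤-trans (n<1+n i) (subst (off ≤_) (odd-move-length e x) (m≤m+n off n'))
    d<n : d < n
    d<n = <-trans (n<1+n d) i<n
    wf : claim G b (path i) sta (path d) ≡ free
    wf = claim-keeps-free b (path i) sta (<⇒≢ (n<1+n d) ∘ path-injective d i d<n i<n) (path-free d d<n)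
    avoid : ∀ j → Blocks.InBlocks e n 0 j → j ≢ d × path j ≢ path i
    avoid j (inj₁ j<d) = <⇒≢ j<d ,
                         <⇒≢ (<-trans j<d (n<1+n d)) ∘ path-injective j i (<-trans j<d d<n) i<n
    avoid j (inj₂ (n≤j , j<n+0)) = contradiction (subst (j <_) (+-identityʳ n) j<n+0) (≤⇒≯ n≤j)
    open Answer Z uf d<n wf (Pairing-round-unpaired pairing uf (path-unpaired i i<n) (path d) wf)
                {a = e} {n} {0} (<⇒≤ d<n) (+-identityʳ n) avoid
    window : ∀ t → t < n' → Leftover (off + t) × path (off + t) ≢ path i
    window t t<n' =
      (≤-trans (≤-trans (n≤1+n d) (n≤1+n i)) (m≤m+n off t) , off+t<n , far⇒¬Near (m≤m+n off t)) ,
      λ e' → <⇒≢ (<-≤-trans (n<1+n i) (m≤m+n off t)) (sym (path-injective _ _ off+t<n i<n e'))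
      where
      off+t<n : off + t < n
      off+t<n = subst (off + t <_) (odd-move-length e x) (+-monoʳ-< off t<n')
    covers : ∀ j → Leftover j → Σ[ t ∈ ℕ ] t < n' × j ≡ off + t
    covers j (d≤j , j<n , far) with m≤n⇒∃[o]m+o≡n {m = off} (¬Near⇒far d≤j far)
    ... | t , refl = t , +-cancelˡ-< off t n' (subst (off + t <_) (sym (odd-move-length e x)) j<n) , refl
    small : 2 ^ r ≤ n'
    small = ≤-trans (2*m≤1+2*n⇒m≤n big)
                    (subst (suc (e + e) + x ≤_) (sym (odd-move-halves e x)) (m≤m+n _ x))

  low-move-safe : ∀ r {b} h (Z : Zone b (suc (2 * suc h))) {i} → i ≤ suc h → ZoneSafe r →
                  2 ^ suc r ≤ suc (2 * suc h) → b (Zone.path Z i) ≡ free →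
                  ¬ StallerWinsAfter r b (Zone.path Z i)
  low-move-safe r h Z {i} i≤ safe big uf with even-or-odd i
  ... | e , inj₁ refl with m≤n⇒∃[o]m+o≡n {m = e} (m+m≤1+n⇒m≤n i≤)
  ...   | f , refl = odd-answer-safe r e f Z uf (λ j j<n → path-injective j (e + e) j<n i<n)
                       (Pairing-round-unpaired pairing uf (path-unpaired (e + e) i<n))
    where
    open Zone Z
    i<n : e + e < suc (2 * suc (e + f))
    i<n = s≤s (≤-trans i≤ (m≤m+n _ _))
  low-move-safe r h Z i≤ safe big uf | e , inj₂ refl with m≤n⇒∃[o]m+o≡n {m = suc (e + e)} i≤
  ...   | x , refl = odd-move-safe r e x Z safe big uf

  move-safe : ∀ r {b} h (Z : Zone b (suc (2 * suc h))) {u} → ZoneSafe r →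
              2 ^ suc r ≤ suc (2 * suc h) → b u ≡ free → ¬ StallerWinsAfter r b u
  move-safe r {b} h Z {u} safe big uf with Zone.onPath? Z u
  ... | yes (i , i<n , refl) with i ≤? suc h
  ...   | yes i≤ = low-move-safe r h Z i≤ safe big uf
  ...   | no i≰ = subst (λ v → b v ≡ free → ¬ StallerWinsAfter r b v)
                          (cong (Zone.path Z) (m∸[m∸n]≡n (≤-pred i<n)))
                          (low-move-safe r h (Zone-reverse Z) reflected safe big) uf
    where
    reflected : 2 * suc h ∸ i ≤ suc h
    reflected = m≤n+o⇒m∸n≤o (2 * suc h) i
                  (subst (_≤ i + suc h) (cong (suc h +_) (sym (+-identityʳ (suc h))))
                         (+-monoˡ-≤ (suc h) (<⇒≤ (≰⇒> i≰))))
  move-safe r h Z {u} safe big uf | no off with pairing-answer (Zone.pairing Z) uf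
  ... | inj₁ (u' , pu , u'f , pairing') =
        λ next → safe (suc h) (Zone-round Z uf u'f off pu pairing') (≤-trans (m≤m+n _ _) big) (next u' u'f)
  ... | inj₂ pairing-after =
        odd-answer-safe r 0 h Z uf (λ j j<n pj≡u → contradiction (j , j<n , sym pj≡u) off) pairing-after

  zone-safe : ∀ r → ZoneSafe r
  zone-safe zero _ _ _ ()
  zone-safe (suc r) zero _ big _ = 1+n≰n (≤-trans (*-monoʳ-≤ 2 (m^n>0 2 r)) big)
  zone-safe (suc r) (suc h) Z _ (u , uf , inj₁ (v , owns)) = zone-no-win Z (s≤s (s≤s z≤n)) uf owns
  zone-safe (suc r) (suc h) Z big (u , uf , inj₂ (_ , next)) = move-safe r h Z (zone-safe r) big uf next

module ThreeLegs (K : ℕ) where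

  legs : List ℕ
  legs = K ∷ K ∷ K ∷ []

  S : Graph
  S = SubdividedStar legs

  open Graph S using (V)
  open Moves S

  centre : V
  centre = nothing

  leg-length : ∀ i → lookup legs i ≡ K
  leg-length fzero = refl
  leg-length (fsuc fzero) = refl
  leg-length (fsuc (fsuc fzero)) = refl

  <K⇒<leg : ∀ i {j} → j < K → j < lookup legs i
  <K⇒<leg i {j} j<K = subst (j <_) (sym (leg-length i)) j<K

  toℕ<K : ∀ i (J : Fin (lookup legs i)) → toℕ J < K
  toℕ<K i J = subst (toℕ J <_) (leg-length i) (toℕ<n J)

  -- Vertex j of leg i, counted from the centre; the junk value for j ≥ K is the centre.
  leg : Fin 3 → ℕ → V
  leg i j with j <? lookup legs i
  ... | yes j< = just (i , fromℕ< j<)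
  ... | no _ = centre

  leg-just : ∀ i {j} (j< : j < lookup legs i) → leg i j ≡ just (i , fromℕ< j<)
  leg-just i {j} j< with j <? lookup legs i
  ... | yes _ = refl
  ... | no j≮ = contradiction j< j≮

  leg-toℕ : ∀ i (J : Fin (lookup legs i)) → leg i (toℕ J) ≡ just (i , J)
  leg-toℕ i J = trans (leg-just i (toℕ<n J)) (cong (λ J' → just (i , J')) (fromℕ<-toℕ J (toℕ<n J)))

  vertex-view : ∀ v → v ≡ centre ⊎ Σ[ i ∈ Fin 3 ] Σ[ j ∈ ℕ ] j < K × v ≡ leg i j
  vertex-view nothing = inj₁ refl
  vertex-view (just (i , J)) = inj₂ (i , toℕ J , toℕ<K i J , sym (leg-toℕ i J))

  leg-injective : ∀ {i i' j j'} → j < K → j' < K → leg i j ≡ leg i' j' → i ≡ i' × j ≡ j'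
  leg-injective {i} {i'} {j} {j'} j<K j'<K e
    rewrite leg-just i (<K⇒<leg i j<K) | leg-just i' (<K⇒<leg i' j'<K) =
    cong proj₁ (just-injective e) ,
    trans (sym (toℕ-fromℕ< _)) (trans (cong (toℕ ∘ proj₂) (just-injective e)) (toℕ-fromℕ< _))

  leg≢centre : ∀ i {j} → j < K → leg i j ≢ centre
  leg≢centre i j<K e rewrite leg-just i (<K⇒<leg i j<K) = contradiction e λ ()

  leg-adjacent : ∀ i {j} → suc j < K → leg i (suc j) ∈N leg i j × leg i j ∈N leg i (suc j)
  leg-adjacent i {j} sj<K
    rewrite leg-just i (<K⇒<leg i (<-trans (n<1+n j) sj<K)) | leg-just i (<K⇒<leg i sj<K) =
    inj₂ (leg-next i _ _ steps) , inj₂ (leg-prev i _ _ steps)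
    where
    steps : toℕ (fromℕ< (<K⇒<leg i sj<K)) ≡ suc (toℕ (fromℕ< (<K⇒<leg i (<-trans (n<1+n j) sj<K))))
    steps = trans (toℕ-fromℕ< _) (cong suc (sym (toℕ-fromℕ< _)))

  centre-adjacent : ∀ i → 0 < K → leg i 0 ∈N centre × centre ∈N leg i 0
  centre-adjacent i 0<K rewrite leg-just i (<K⇒<leg i 0<K) =
    inj₂ (centre-leg i _ (toℕ-fromℕ< _)) , inj₂ (leg-centre i _ (toℕ-fromℕ< _))

  leg-neighbour : ∀ i {j u} → j < K → StarAdj legs (leg i j) u →
                  (j ≡ 0 × u ≡ centre) ⊎ (suc j < K × u ≡ leg i (suc j)) ⊎
                  (Σ[ j' ∈ ℕ ] j ≡ suc j' × u ≡ leg i j')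
  leg-neighbour i {j} j<K adj rewrite leg-just i (<K⇒<leg i j<K) with adj
  ... | leg-centre _ _ e = inj₁ (trans (sym (toℕ-fromℕ< _)) e , refl)
  ... | leg-next _ _ J' e =
        inj₂ (inj₁ (subst (_< K) e' (toℕ<K i J') , trans (sym (leg-toℕ i J')) (cong (leg i) e')))
    where
    e' : toℕ J' ≡ suc j
    e' = trans e (cong suc (toℕ-fromℕ< _))
  ... | leg-prev _ _ J' e = inj₂ (inj₂ (toℕ J' , trans (sym (toℕ-fromℕ< _)) e , sym (leg-toℕ i J')))

  centre-neighbour : ∀ {u} → StarAdj legs centre u → Σ[ i ∈ Fin 3 ] u ≡ leg i 0
  centre-neighbour (centre-leg i J e) = i , trans (sym (leg-toℕ i J)) (cong (leg i) e)

  leg-near : ∀ i {j j'} → j < K → j' < K → Near j j' → leg i j' ∈N leg i j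
  leg-near i _ _ (inj₁ refl) = inj₁ refl
  leg-near i j<K _ (inj₂ (inj₁ refl)) = proj₂ (leg-adjacent i j<K)
  leg-near i _ j'<K (inj₂ (inj₂ refl)) = proj₁ (leg-adjacent i j'<K)

  legs-differ : ∀ i i' {j j'} → i ≢ i' → j < K → j' < K → leg i j ≢ leg i' j'
  legs-differ _ _ i≢i' j<K j'<K = i≢i' ∘ proj₁ ∘ leg-injective j<K j'<K

  indices-differ : ∀ i {j j'} → j ≢ j' → j < K → j' < K → leg i j ≢ leg i j'
  indices-differ _ j≢j' j<K j'<K = j≢j' ∘ proj₂ ∘ leg-injective j<K j'<K

module Star (k₀ : ℕ) where
  open ThreeLegs (2 * suc k₀)
  open Graph S using (V) renaming (_≟_ to _≟ᵥ_)
  open Moves S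
  open PathStrategy S
  open Pairings S
  open Zones S

  K : ℕ
  K = 2 * suc k₀

  K≡ : K ≡ suc (suc (2 * k₀))
  K≡ = *-suc 2 k₀

  0<K : 0 < K
  0<K = z<s

  tail<K : ∀ {j} → j < suc (2 * k₀) → suc j < K
  tail<K {j} j< = subst (suc j <_) (sym K≡) (s≤s j<)

  leg-tail-path : ∀ {b} i → b (leg i 0) ≡ sta →
                  (∀ j → j < suc (2 * k₀) → b (leg i (suc j)) ≡ free) →
                  StallerPath b (leg i ∘ suc) (suc (2 * k₀))
  leg-tail-path {b} i sta₀ tail-free = record
    { path-free = tail-free
    ; path-injective = λ j j' j< j'< → suc-injective ∘ proj₂ ∘ leg-injective (tail<K j<) (tail<K j'<)
    ; path-closed = closed }
    where
    closed : ∀ j → j < suc (2 * k₀) → ∀ u → u ∈N leg i (suc j) →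
             (Σ[ s ∈ ℕ ] s < suc (2 * k₀) × Near j s × u ≡ leg i (suc s)) ⊎ b u ≡ sta
    closed j j< u (inj₁ u≡) = inj₁ (j , j< , inj₁ refl , u≡)
    closed j j< u (inj₂ adj) with leg-neighbour i (tail<K j<) adj
    ... | inj₂ (inj₁ (ssj<K , refl)) =
          inj₁ (suc j , ≤-pred (subst (suc (suc (suc j)) ≤_) K≡ ssj<K) , inj₂ (inj₂ refl) , refl)
    ... | inj₂ (inj₂ (zero , refl , refl)) = inj₂ sta₀
    ... | inj₂ (inj₂ (suc j' , refl , refl)) = inj₁ (j' , <-trans (n<1+n j') j< , inj₂ (inj₁ refl) , refl)

  spoke : Fin 3 → ℕ → V
  spoke c zero = centre
  spoke c (suc j) = leg c j

  spoke-injective : ∀ c {a a'} → a < suc K → a' < suc K → spoke c a ≡ spoke c a' → a ≡ a'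
  spoke-injective c {zero} {zero} _ _ _ = refl
  spoke-injective c {zero} {suc a'} _ a'< e = contradiction (sym e) (leg≢centre c (≤-pred a'<))
  spoke-injective c {suc a} {zero} a< _ e = contradiction e (leg≢centre c (≤-pred a<))
  spoke-injective c {suc a} {suc a'} a< a'< e = cong suc (proj₂ (leg-injective (≤-pred a<) (≤-pred a'<) e))

  spoke-adjacent : ∀ c a → suc a < suc K → spoke c (suc a) ∈N spoke c a × spoke c a ∈N spoke c (suc a)
  spoke-adjacent c zero _ = centre-adjacent c 0<K
  spoke-adjacent c (suc a) a< = leg-adjacent c (≤-pred a<)

  spoke-path : ∀ {b} c → (∀ i → i ≢ c → b (leg i 0) ≡ sta) → b centre ≡ free →
               (∀ j → j < K → b (leg c j) ≡ free) → StallerPath b (spoke c) (suc K)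
  spoke-path {b} c others-sta centre-free leg-free = record
    { path-free = spoke-free
    ; path-injective = λ _ _ → spoke-injective c
    ; path-closed = closed }
    where
    spoke-free : ∀ j → j < suc K → b (spoke c j) ≡ free
    spoke-free zero _ = centre-free
    spoke-free (suc j) j< = leg-free j (≤-pred j<)
    closed : ∀ j → j < suc K → ∀ u → u ∈N spoke c j →
             (Σ[ s ∈ ℕ ] s < suc K × Near j s × u ≡ spoke c s) ⊎ b u ≡ sta
    closed j j< u (inj₁ u≡) = inj₁ (j , j< , inj₁ refl , u≡)
    closed zero _ u (inj₂ adj) with centre-neighbour adj
    ... | i , refl with i ≟ᶠ c
    ...   | yes refl = inj₁ (1 , s≤s (s≤s z≤n) , inj₂ (inj₂ refl) , refl)
    ...   | no i≢c = inj₂ (others-sta i i≢c)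
    closed (suc j) j< u (inj₂ adj) with leg-neighbour c (≤-pred j<) adj
    ... | inj₁ (refl , refl) = inj₁ (0 , z<s , inj₂ (inj₁ refl) , refl)
    ... | inj₂ (inj₁ (sj<K , refl)) = inj₁ (suc (suc j) , s≤s sj<K , inj₂ (inj₂ refl) , refl)
    ... | inj₂ (inj₂ (j' , refl , refl)) = inj₁ (suc j' , <-trans (n<1+n _) j< , inj₂ (inj₁ refl) , refl)

  board₀ : Board S
  board₀ = emptyBoard S

  a₀ b₀ : V
  a₀ = leg fzero 0
  b₀ = leg (fsuc fzero) 0

  tail-wins : ∀ r {b} i {w} (uf : b (leg i 0) ≡ free) (wf : claim S b (leg i 0) sta w ≡ free) →
              (∀ j → j < suc (2 * k₀) → b (leg i (suc j)) ≡ free) →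
              ¬ (Σ[ j ∈ ℕ ] j < suc (2 * k₀) × w ≡ leg i (suc j)) → k₀ < 2 ^ r →
              StallerWinsWithin S (suc r) (round b (leg i 0) w)
  tail-wins r {b} i {w} uf wf tail-free w∉tail k₀< =
    path-wins r k₀ k₀< (leg-tail-path i round-sta λ j j< →
      round-keeps-free (indices-differ i (λ ()) (tail<K j<) 0<K) (λ e → w∉tail (j , j< , sym e))
                       (tail-free j j<))
    where open Round {b} {leg i 0} {w} uf wf

  module AfterLeg₀ {m} (m< : m < suc (2 * k₀))
                   (w₁f : claim S board₀ a₀ sta (leg fzero (suc m)) ≡ free) where
    open Round {board₀} {a₀} {leg fzero (suc m)} refl w₁f

    board₁ : Board S
    board₁ = round board₀ a₀ (leg fzero (suc m))

    free₁ : ∀ {y} → y ≢ a₀ → y ≢ leg fzero (suc m) → board₁ y ≡ free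
    free₁ y≢a₀ y≢w₁ = round-keeps-free y≢a₀ y≢w₁ refl

    b₀-free : board₁ b₀ ≡ free
    b₀-free = free₁ (legs-differ (fsuc fzero) fzero (λ ()) 0<K 0<K)
                    (legs-differ (fsuc fzero) fzero (λ ()) 0<K (tail<K m<))

    centre-free₁ : board₁ centre ≡ free
    centre-free₁ = free₁ (leg≢centre fzero 0<K ∘ sym) (leg≢centre fzero (tail<K m<) ∘ sym)

    spoke-wins : ∀ t {m'} → m' < suc (2 * k₀) → suc k₀ < 2 ^ t →
                 (w₂f : claim S board₁ b₀ sta (leg (fsuc fzero) (suc m')) ≡ free) →
                 StallerWinsWithin S (suc t) (round board₁ b₀ (leg (fsuc fzero) (suc m')))
    spoke-wins t {m'} m'< k<2^t w₂f =
      path-wins t (suc k₀) k<2^t (spoke-path c others-sta centre-free₂ leg-free₂)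
      where
      c : Fin 3
      c = fsuc (fsuc fzero)
      module R₂ = Round {w = leg (fsuc fzero) (suc m')} b₀-free w₂f
      others-sta : ∀ i → i ≢ c → round board₁ b₀ (leg (fsuc fzero) (suc m')) (leg i 0) ≡ sta
      others-sta fzero _ = R₂.round-keeps-claimed {a₀} round-sta λ ()
      others-sta (fsuc fzero) _ = R₂.round-sta
      others-sta (fsuc (fsuc fzero)) i≢c = contradiction refl i≢c
      centre-free₂ : round board₁ b₀ (leg (fsuc fzero) (suc m')) centre ≡ free
      centre-free₂ = R₂.round-keeps-free (leg≢centre (fsuc fzero) 0<K ∘ sym)
                                         (leg≢centre (fsuc fzero) (tail<K m'<) ∘ sym) centre-free₁
      leg-free₂ : ∀ j → j < K → round board₁ b₀ (leg (fsuc fzero) (suc m')) (leg c j) ≡ free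
      leg-free₂ j j<K =
        R₂.round-keeps-free (legs-differ c (fsuc fzero) (λ ()) j<K 0<K)
                            (legs-differ c (fsuc fzero) (λ ()) j<K (tail<K m'<))
          (free₁ (legs-differ c fzero (λ ()) j<K 0<K) (legs-differ c fzero (λ ()) j<K (tail<K m<)))

    leg₁-wins : ∀ t → suc k₀ < 2 ^ t → StallerWinsWithin S (suc (suc t)) board₁
    leg₁-wins t k<2^t = b₀ , b₀-free , inj₂ ((centre , centre-free) , answer)
      where
      centre-free : claim S board₁ b₀ sta centre ≡ free
      centre-free = claim-keeps-free board₁ b₀ sta (leg≢centre (fsuc fzero) 0<K ∘ sym) centre-free₁
      answer : StallerWinsAfter (suc t) board₁ b₀
      answer w₂ w₂f with anyUpTo? (λ j → w₂ ≟ᵥ leg (fsuc fzero) (suc j)) (suc (2 * k₀))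
      ... | no w₂∉tail =
            tail-wins t (fsuc fzero) b₀-free w₂f tail-free w₂∉tail (<-trans (n<1+n k₀) k<2^t)
        where
        tail-free : ∀ j → j < suc (2 * k₀) → board₁ (leg (fsuc fzero) (suc j)) ≡ free
        tail-free j j< = free₁ (legs-differ (fsuc fzero) fzero (λ ()) (tail<K j<) 0<K)
                               (legs-differ (fsuc fzero) fzero (λ ()) (tail<K j<) (tail<K m<))
      ... | yes (m' , m'< , refl) = spoke-wins t m'< k<2^t w₂f

  star-wins : ∀ t → suc k₀ < 2 ^ t → StallerWinsWithin S (suc (suc (suc t))) board₀
  star-wins t k<2^t =
    a₀ , refl , inj₂ ((centre , claim-keeps-free board₀ a₀ sta (leg≢centre fzero 0<K ∘ sym) refl) , answer)
    where
    answer : StallerWinsAfter (suc (suc t)) board₀ a₀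
    answer w₁ w₁f with anyUpTo? (λ j → w₁ ≟ᵥ leg fzero (suc j)) (suc (2 * k₀))
    ... | no w₁∉tail = tail-wins (suc t) fzero refl w₁f (λ _ _ → refl) w₁∉tail
                         (<-≤-trans (<-trans (n<1+n k₀) k<2^t) (m≤m+n _ _))
    ... | yes (m , m< , refl) = AfterLeg₀.leg₁-wins m< w₁f t k<2^t

  K≡k+k : K ≡ suc k₀ + suc k₀
  K≡k+k = cong (suc k₀ +_) (+-identityʳ (suc k₀))

  mate<K : ∀ {j} → j < K → mate j < K
  mate<K {j} j<K = subst (mate j <_) (sym K≡k+k) (mate-< (suc k₀) (subst (j <_) K≡k+k j<K))

  first-move-no-win : ∀ u v → ¬ (∀ y → y ∈N v → claim S board₀ u sta y ≡ sta)
  first-move-no-win u v owns with vertex-view v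
  ... | inj₁ refl =
        leg≢centre fzero 0<K (two-free (proj₁ (centre-adjacent fzero 0<K)) (inj₁ refl) refl refl)
    where open StallerClaims owns
  ... | inj₂ (i , j , j<K , refl) =
        mate-irrefl j (proj₂ (leg-injective (mate<K j<K) j<K
          (two-free (leg-near i j<K (mate<K j<K) (mate-near j)) (inj₁ refl) refl refl)))
    where open StallerClaims owns

  opening-free-or-dom : ∀ u w (wf : claim S board₀ u sta w ≡ free) {y} → y ≢ u →
                        round board₀ u w y ≡ free ⊎ round board₀ u w y ≡ dom
  opening-free-or-dom u w wf {y} y≢u = by-cases (y ≟ᵥ w)
    where
    open Round {board₀} {u} {w} refl wf
    by-cases : Dec (y ≡ w) → round board₀ u w y ≡ free ⊎ round board₀ u w y ≡ dom
    by-cases (yes refl) = inj₂ round-dom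
    by-cases (no y≢w) = inj₁ (round-keeps-free y≢u y≢w refl)

  legPartner : (Fin 3 → Bool) → V → Maybe V
  legPartner paired nothing = nothing
  legPartner paired (just (i , J)) = if paired i then just (leg i (mate (toℕ J))) else nothing

  legPartner-leg : ∀ paired i {j} → j < K →
                   legPartner paired (leg i j) ≡ (if paired i then just (leg i (mate j)) else nothing)
  legPartner-leg paired i j<K rewrite leg-just i (<K⇒<leg i j<K) | toℕ-fromℕ< (<K⇒<leg i j<K) = refl

  data LegMates (paired : Fin 3 → Bool) : V → V → Set where
    leg-mates : ∀ i {j} → paired i ≡ true → j < K → LegMates paired (leg i j) (leg i (mate j))

  legPartner-view : ∀ paired {y z} → legPartner paired y ≡ just z → LegMates paired y z
  legPartner-view paired {just (i , J)} e with paired i in paired-i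
  ... | true rewrite sym (just-injective e) =
        subst (λ y → LegMates paired y (leg i (mate (toℕ J)))) (leg-toℕ i J)
              (leg-mates i paired-i (toℕ<K i J))

  legPairing : ∀ {b} paired →
               (∀ i {j} → paired i ≡ true → j < K → Intact b (leg i j) (leg i (mate j))) →
               Pairing b (legPartner paired)
  legPairing {b} paired intact = record
    { partner-sym = λ y z e → partner-sym (legPartner-view paired e)
    ; partner-irrefl = λ y z e → partner-irrefl (legPartner-view paired e)
    ; partner-intact = λ y z e → partner-intact (legPartner-view paired e) }
    where
    partner-sym : ∀ {y z} → LegMates paired y z → legPartner paired z ≡ just y
    partner-sym (leg-mates i {j} paired-i j<K) rewrite legPartner-leg paired i (mate<K j<K) | paired-i =
      cong (just ∘ leg i) (mate-involutive j)
    partner-irrefl : ∀ {y z} → LegMates paired y z → y ≢ z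
    partner-irrefl (leg-mates i {j} _ j<K) e =
      mate-irrefl j (sym (proj₂ (leg-injective j<K (mate<K j<K) e)))
    partner-intact : ∀ {y z} → LegMates paired y z → Intact b y z
    partner-intact (leg-mates i paired-i j<K) = intact i paired-i j<K

  leg-guarded : ∀ {b} paired i {j} → paired i ≡ true → j < K → Guarded b (legPartner paired) (leg i j)
  leg-guarded paired i {j} paired-i j<K =
    inj₂ (leg i j , leg i (mate j) , inj₁ refl , leg-near i j<K (mate<K j<K) (mate-near j) ,
          trans (legPartner-leg paired i j<K) (cong (λ p → if p then _ else nothing) paired-i))

  centre-opening-blocked : (wf : claim S board₀ centre sta a₀ ≡ free) → Blocked (round board₀ centre a₀)
  centre-opening-blocked wf = record
    { partner = legPartner λ _ → true
    ; pairing = legPairing (λ _ → true) λ i {j} _ j<K →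
        intact-free-or-dom (round board₀ centre a₀) {leg i j} {leg i (mate j)}
          (opening-free-or-dom centre a₀ wf (leg≢centre i j<K))
          (opening-free-or-dom centre a₀ wf (leg≢centre i (mate<K j<K)))
    ; guarded = guarded }
    where
    guarded : ∀ v → Guarded (round board₀ centre a₀) (legPartner λ _ → true) v
    guarded v with vertex-view v
    ... | inj₁ refl =
          inj₁ (a₀ , proj₁ (centre-adjacent fzero 0<K) , Round.round-dom {board₀} {centre} {a₀} refl wf)
    ... | inj₂ (i , j , j<K , refl) = leg-guarded (λ _ → true) i refl j<K

  record OtherLegs (s : Fin 3) : Set where
    field
      p q : Fin 3
      p≢q : p ≢ q
      p≢s : p ≢ s
      q≢s : q ≢ s
      cover : ∀ i → i ≡ s ⊎ i ≡ p ⊎ i ≡ q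

  otherLegs : ∀ s → OtherLegs s
  otherLegs fzero = record
    { p = fsuc fzero ; q = fsuc (fsuc fzero) ; p≢q = λ () ; p≢s = λ () ; q≢s = λ () ; cover = cover }
    where
    cover : ∀ i → i ≡ fzero ⊎ i ≡ fsuc fzero ⊎ i ≡ fsuc (fsuc fzero)
    cover fzero = inj₁ refl
    cover (fsuc fzero) = inj₂ (inj₁ refl)
    cover (fsuc (fsuc fzero)) = inj₂ (inj₂ refl)
  otherLegs (fsuc fzero) = record
    { p = fzero ; q = fsuc (fsuc fzero) ; p≢q = λ () ; p≢s = λ () ; q≢s = λ () ; cover = cover }
    where
    cover : ∀ i → i ≡ fsuc fzero ⊎ i ≡ fzero ⊎ i ≡ fsuc (fsuc fzero)
    cover fzero = inj₂ (inj₁ refl)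
    cover (fsuc fzero) = inj₁ refl
    cover (fsuc (fsuc fzero)) = inj₂ (inj₂ refl)
  otherLegs (fsuc (fsuc fzero)) = record
    { p = fzero ; q = fsuc fzero ; p≢q = λ () ; p≢s = λ () ; q≢s = λ () ; cover = cover }
    where
    cover : ∀ i → i ≡ fsuc (fsuc fzero) ⊎ i ≡ fzero ⊎ i ≡ fsuc fzero
    cover fzero = inj₂ (inj₁ refl)
    cover (fsuc fzero) = inj₂ (inj₂ refl)
    cover (fsuc (fsuc fzero)) = inj₁ refl

  K₀ : ℕ
  K₀ = suc (2 * k₀)

  K₀<K : K₀ < K
  K₀<K = subst (K₀ <_) (sym K≡) (n<1+n K₀)

  K₀∸<K : ∀ m → K₀ ∸ m < K
  K₀∸<K m = ≤-<-trans (m∸n≤m K₀ m) K₀<K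

  2K≡K+K : 2 * K ≡ K + K
  2K≡K+K = cong (K +_) (+-identityʳ K)

  past-K : ∀ {a} → K + a < suc (2 * K) → a < suc K
  past-K {a} lt = s≤s (+-cancelˡ-≤ K a K (≤-pred (subst (K + a <_) (cong suc 2K≡K+K) lt)))

  past-K⁻¹ : ∀ {a} → a < suc K → K + a < suc (2 * K)
  past-K⁻¹ {a} a< = subst (K + a <_) (cong suc (sym 2K≡K+K)) (s≤s (+-monoʳ-≤ K (≤-pred a<)))

  module Through (p q : Fin 3) (p≢q : p ≢ q) where

    -- From the far end of leg p through the centre to the far end of leg q.
    through : ℕ → V
    through m with m ≤? K₀
    ... | yes _ = leg p (K₀ ∸ m)
    ... | no _ = spoke q (m ∸ K)

    through-low : ∀ {m} → m ≤ K₀ → through m ≡ leg p (K₀ ∸ m)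
    through-low {m} m≤ with m ≤? K₀
    ... | yes _ = refl
    ... | no m≰ = contradiction m≤ m≰

    through-high : ∀ a → through (K + a) ≡ spoke q a
    through-high a with K + a ≤? K₀
    ... | yes K+a≤ = contradiction (<-≤-trans K₀<K (m≤m+n K a)) (≤⇒≯ K+a≤)
    ... | no _ = cong (spoke q) (m+n∸m≡n K a)

    through-view : ∀ m → m ≤ K₀ ⊎ Σ[ a ∈ ℕ ] K + a ≡ m
    through-view m with m ≤? K₀
    ... | yes m≤ = inj₁ m≤
    ... | no m≰ = inj₂ (m≤n⇒∃[o]m+o≡n {m = K} (subst (_≤ m) (sym K≡) (≰⇒> m≰)))

    leg≢spoke : ∀ {x a} → x < K → a < suc K → leg p x ≢ spoke q a
    leg≢spoke {a = zero} x<K _ = leg≢centre p x<K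
    leg≢spoke {a = suc a} x<K a< = legs-differ p q p≢q x<K (≤-pred a<)

    through-injective : ∀ m m' → m < suc (2 * K) → m' < suc (2 * K) → through m ≡ through m' → m ≡ m'
    through-injective m m' m< m'< e with through-view m | through-view m'
    ... | inj₁ l | inj₁ l' = ∸-cancelˡ-≡ l l'
          (proj₂ (leg-injective (K₀∸<K m) (K₀∸<K m')
                   (trans (sym (through-low l)) (trans e (through-low l')))))
    ... | inj₁ l | inj₂ (a' , refl) =
          contradiction (trans (sym (through-low l)) (trans e (through-high a')))
                        (leg≢spoke (K₀∸<K m) (past-K m'<))
    ... | inj₂ (a , refl) | inj₁ l' =
          contradiction (trans (sym (through-low l')) (trans (sym e) (through-high a)))
                        (leg≢spoke (K₀∸<K m') (past-K m<))
    ... | inj₂ (a , refl) | inj₂ (a' , refl) =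
          cong (K +_) (spoke-injective q (past-K m<) (past-K m'<)
                        (trans (sym (through-high a)) (trans e (through-high a'))))

    adjacent-cong : ∀ {x x' y y'} → x ≡ x' → y ≡ y' → x' ∈N y' × y' ∈N x' → x ∈N y × y ∈N x
    adjacent-cong refl refl adj = adj

    through-adjacent : ∀ m → suc m < suc (2 * K) →
                       through (suc m) ∈N through m × through m ∈N through (suc m)
    through-adjacent m sm< with through-view m
    ... | inj₂ (a , refl) =
          adjacent-cong (trans (cong through (sym (+-suc K a))) (through-high (suc a))) (through-high a)
            (spoke-adjacent q a (past-K (subst (_< suc (2 * K)) (sym (+-suc K a)) sm<)))
    ... | inj₁ m≤ with m ≟ K₀
    ...   | yes refl = adjacent-cong (trans (cong through (sym (trans (+-identityʳ K) K≡))) (through-high 0))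
                         (trans (through-low m≤) (cong (leg p) (n∸n≡0 K₀)))
                         (swap (centre-adjacent p 0<K))
    ...   | no m≢ = adjacent-cong (through-low m<) (trans (through-low m≤) (cong (leg p) (+-∸-assoc 1 m<)))
                      (swap (leg-adjacent p (subst (_< K) (+-∸-assoc 1 m<) (K₀∸<K m))))
      where
      m< : m < K₀
      m< = ≤∧≢⇒< m≤ m≢

    through-on : ∀ m → m < suc (2 * K) →
                 through m ≡ centre ⊎ Σ[ x ∈ ℕ ] x < K × (through m ≡ leg p x ⊎ through m ≡ leg q x)
    through-on m m< with through-view m
    ... | inj₁ m≤ = inj₂ (K₀ ∸ m , K₀∸<K m , inj₁ (through-low m≤))
    ... | inj₂ (zero , refl) = inj₁ (through-high 0)
    ... | inj₂ (suc a , refl) = inj₂ (a , ≤-pred (past-K m<) , inj₂ (through-high (suc a)))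

    through-leg-p : ∀ {x} → x < K → through (K₀ ∸ x) ≡ leg p x
    through-leg-p {x} x<K =
      trans (through-low (m∸n≤m K₀ x)) (cong (leg p) (m∸[m∸n]≡n (≤-pred (subst (x <_) K≡ x<K))))

  module LegOpening (s : Fin 3) {j} (j<K : j < K)
                    (wf : claim S board₀ (leg s j) sta (leg s (mate j)) ≡ free) where
    open OtherLegs (otherLegs s)
    open Through p q p≢q
    open Round {board₀} {leg s j} {leg s (mate j)} refl wf

    paired : Fin 3 → Bool
    paired i = does (i ≟ᶠ s)

    opening : Board S
    opening = round board₀ (leg s j) (leg s (mate j))

    intact-s : ∀ {x} → x < K → Intact opening (leg s x) (leg s (mate x))
    intact-s {x} x<K with x ≟ j | mate x ≟ j
    ... | yes x≡j | _ = inj₂ (inj₂ (subst (λ y → opening (leg s (mate y)) ≡ dom) (sym x≡j) round-dom))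
    ... | no _ | yes mx≡j =
          inj₂ (inj₁ (subst (λ y → opening (leg s y) ≡ dom)
                            (trans (cong mate (sym mx≡j)) (mate-involutive x)) round-dom))
    ... | no x≢j | no mx≢j = intact-free-or-dom opening {leg s x} {leg s (mate x)}
                               (opening-free-or-dom _ _ wf (indices-differ s x≢j x<K j<K))
                               (opening-free-or-dom _ _ wf (indices-differ s mx≢j (mate<K x<K) j<K))

    intact : ∀ i {x} → paired i ≡ true → x < K → Intact opening (leg i x) (leg i (mate x))
    intact i paired-i x<K with i ≟ᶠ s
    ... | yes refl = intact-s x<K
    ... | no _ = contradiction paired-i λ ()

    off-s : ∀ m → m < suc (2 * K) → ∀ {x} → x < K → through m ≢ leg s x
    off-s m m< x<K e with through-on m m<
    ... | inj₁ e' = leg≢centre s x<K (trans (sym e) e')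
    ... | inj₂ (y , y<K , inj₁ e') = legs-differ p s p≢s y<K x<K (trans (sym e') e)
    ... | inj₂ (y , y<K , inj₂ e') = legs-differ q s q≢s y<K x<K (trans (sym e') e)

    unpaired-off : ∀ i {x} → i ≢ s → x < K → legPartner paired (leg i x) ≡ nothing
    unpaired-off i i≢s x<K =
      trans (legPartner-leg paired i x<K) (cong (λ b → if b then _ else nothing) (dec-false (i ≟ᶠ s) i≢s))

    unpaired : ∀ m → m < suc (2 * K) → legPartner paired (through m) ≡ nothing
    unpaired m m< with through-on m m<
    ... | inj₁ e = cong (legPartner paired) e
    ... | inj₂ (y , y<K , inj₁ e) = trans (cong (legPartner paired) e) (unpaired-off p p≢s y<K)
    ... | inj₂ (y , y<K , inj₂ e) = trans (cong (legPartner paired) e) (unpaired-off q q≢s y<K)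

    guarded : ∀ v → Guarded opening (legPartner paired) v ⊎
                    (Σ[ m ∈ ℕ ] m < suc (2 * K) × v ≡ through m)
    guarded v with vertex-view v
    ... | inj₁ refl = inj₂ (K + 0 , past-K⁻¹ z<s , sym (through-high 0))
    ... | inj₂ (i , x , x<K , refl) with cover i
    ...   | inj₁ refl = inj₁ (leg-guarded paired s (dec-true (s ≟ᶠ s) refl) x<K)
    ...   | inj₂ (inj₁ refl) =
            inj₂ (K₀ ∸ x , <-≤-trans (K₀∸<K x) (≤-trans (m≤m+n K _) (n≤1+n _)) , sym (through-leg-p x<K))
    ...   | inj₂ (inj₂ refl) = inj₂ (K + suc x , past-K⁻¹ (s≤s x<K) , sym (through-high (suc x)))

    zone : Zone opening (suc (2 * K))
    zone = record
      { partner = legPartner paired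
      ; pairing = legPairing paired intact
      ; path = through
      ; path-free = λ m m< → round-keeps-free (off-s m m< j<K) (off-s m m< (mate<K j<K)) refl
      ; path-unpaired = unpaired
      ; path-injective = through-injective
      ; path-adjacent = through-adjacent
      ; guarded = guarded }

  star-safe : ∀ r → 2 ^ r ≤ suc (2 * K) → ¬ StallerWinsWithin S (suc r) board₀
  star-safe r _ (u , _ , inj₁ (v , owns)) = first-move-no-win u v owns
  star-safe r big (u , _ , inj₂ (_ , next)) with vertex-view u
  ... | inj₁ refl = blocked-safe r (centre-opening-blocked a₀-free) (next a₀ a₀-free)
    where
    a₀-free : claim S board₀ centre sta a₀ ≡ free
    a₀-free = claim-keeps-free board₀ centre sta (leg≢centre fzero 0<K) refl
  ... | inj₂ (s , j , j<K , refl) =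
        zone-safe r K (LegOpening.zone s j<K mate-free) big (next (leg s (mate j)) mate-free)
    where
    mate-free : claim S board₀ (leg s j) sta (leg s (mate j)) ≡ free
    mate-free = claim-keeps-free board₀ (leg s j) sta (indices-differ s (mate-irrefl j) (mate<K j<K) j<K) refl

  too-short : ∀ {t} → suc (4 * suc k₀) ≤ 2 ^ t → t ≤ 2 → ⊥
  too-short big t≤2 = 1+n≰n (≤-trans (s≤s (*-monoʳ-≤ 4 (s≤s z≤n))) (≤-trans big (^-monoʳ-≤ 2 t≤2)))

  star-upper : ∀ t → suc (4 * suc k₀) ≤ 2 ^ t → StallerWinsWithin S (t + 1) board₀
  star-upper zero big = ⊥-elim (too-short big z≤n)
  star-upper (suc zero) big = ⊥-elim (too-short big (s≤s z≤n))
  star-upper (suc (suc zero)) big = ⊥-elim (too-short big (s≤s (s≤s z≤n)))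
  star-upper (suc (suc (suc t))) big =
    subst (λ m → StallerWinsWithin S m board₀) (+-comm 1 (suc (suc (suc t)))) (star-wins (suc t) k<2^1+t)
    where
    k<2^1+t : suc k₀ < 2 ^ suc t
    k<2^1+t = *-cancelˡ-< 4 (suc k₀) (2 ^ suc t) (subst (4 * suc k₀ <_) (sym (*-assoc 2 2 (2 ^ suc t))) big)

  star-lower : ∀ t → 2 ^ t ≤ 2 * (4 * suc k₀) → ∀ m → m < t + 1 → ¬ StallerWinsWithin S m board₀
  star-lower t _ zero _ ()
  star-lower t small (suc m) m<t+1 =
    star-safe m (≤-trans 2^m≤4k (≤-trans (≤-reflexive 4k≡2K) (n≤1+n _)))
    where
    2^m≤4k : 2 ^ m ≤ 4 * suc k₀
    2^m≤4k = *-cancelˡ-≤ 2 (≤-trans (^-monoʳ-≤ 2 (≤-pred (subst (suc m <_) (+-comm t 1) m<t+1))) small)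
    4k≡2K : 4 * suc k₀ ≡ 2 * K
    4k≡2K = *-assoc 2 2 (suc k₀)

corollary21 : (k : ℕ) → 1 ≤ k →
    γ'SMB≡ (SubdividedStar (2 * k ∷ 2 * k ∷ 2 * k ∷ [])) (⌈log₂ (4 * k + 1) ⌉ + 1)
corollary21 (suc k₀) _ rewrite +-comm (4 * suc k₀) 1 =
  star-upper t (n≤2^⌈log₂n⌉ _) , star-lower t (2^⌈log₂[1+n]⌉≤2n (4 * suc k₀) (s≤s z≤n))
  where
  open Star k₀
  t : ℕ
  t = ⌈log₂ (suc (4 * suc k₀)) ⌉
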